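{- Let $Q$ be a connected rank $3$ quiver such that $Q^{\mathrm{mut}}$ is mutation-abundant, and let $\mathbf M=m_1m_2\cdots$ be a reduced, weakly balanced mutation sequence which is cycle-preserving on $Q^{\mathrm{mut}}$. Then there is some $i$ such that the sequence $m_im_{i+1}\cdots$ is cycle-preserving on $Q^{(i-1)}_{\mathbf M}$.
   Context: Quiver: finite directed graph without loops or oriented 2-cycles, vertices partitioned into mutable and frozen, arrows between frozen vertices ignored; $b_{ij}$ = #arrows $i\to j$ − #arrows $j\to i$; standard quiver mutation; $Q^{(0)}_{\mathbf M}=Q$, $Q^{(i)}_{\mathbf M}=\mu_{m_i}(Q^{(i-1)}_{\mathbf M})$. Connected: mutable part connected and no isolated frozen vertices. Mutation-abundant: every mutation-equivalent quiver has $|b_{ij}|\ge2$ for distinct $i,j$. Reduced: $m_i\ne m_{i+1}$; weakly balanced: every mutable vertex occurs infinitely often. A 3-vertex quiver is an oriented cycle if it has at most one frozen vertex and is not acyclic. $j$ is cycle-preserving for $P$ if whenever $P|_{ijk}$ is an oriented 3-cycle containing $j$, so is $\mu_j(P)|_{ijk}$. A sequence $m_1m_2\cdots$ is cycle-preserving on a quiver $P$ if each $m_\ell$ is cycle-preserving for the quiver obtained from $P$ by mutating at $m_1,\dots,m_{\ell-1}$; "cycle-preserving on $Q^{\mathrm{mut}}$" means this with $P=Q^{\mathrm{mut}}$. -}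

module Defs where

open import Data.Nat using (ℕ; zero; suc; _≤_)
open import Data.Integer using (ℤ; _+_; _-_; _*_; -_; _⊔_; 0ℤ; _<_; ∣_∣)
open import Data.Fin using (Fin)
import Data.Fin.Properties as FinP
open import Data.Sum using (_⊎_; inj₁; inj₂)
open import Data.Sum.Properties using (≡-dec)
open import Data.Product using (_×_; ∃-syntax)
open import Data.List using (List; []; _∷_)
open import Data.Bool using (Bool; true; false)
open import Relation.Nullary using (¬_; yes; no)
open import Relation.Binary.Definitions using (DecidableEquality)
open import Relation.Binary.PropositionalEquality using (_≡_; _≢_)
open import Relation.Binary.Construct.Closure.ReflexiveTransitive using (Star)

-- A quiver on vertex set V is encoded by its (skew-symmetric) exchange
-- matrix b : V → V → ℤ,  b i j = #arrows i→j − #arrows j→i.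
Mat : Set → Set
Mat V = V → V → ℤ

Skew : {V : Set} → Mat V → Set
Skew {V} b = ∀ (i j : V) → b j i ≡ - b i j

μ : {V : Set} → DecidableEquality V → Mat V → V → Mat V
μ _≟_ b k i j with i ≟ k | j ≟ k
... | yes _ | _     = - b i j
... | no _  | yes _ = - b i j
... | no _  | no _  =
  b i j + (b i k ⊔ 0ℤ) * (b k j ⊔ 0ℤ) - ((- b i k) ⊔ 0ℤ) * ((- b k j) ⊔ 0ℤ)

-- Iterated mutation: iter b m n = b^{(n)}, where m n is the (n+1)-st
-- entry m_{n+1} of the mutation sequence.
iter : {V : Set} → DecidableEquality V → Mat V → (ℕ → V) → ℕ → Mat V
iter _≟_ b m zero    = b
iter _≟_ b m (suc n) = μ _≟_ (iter _≟_ b m n) (m n)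

mutList : {V : Set} → DecidableEquality V → Mat V → List V → Mat V
mutList _≟_ b []       = b
mutList _≟_ b (k ∷ ks) = mutList _≟_ (μ _≟_ b k) ks

-- Rank-3 quivers with f frozen vertices: mutable vertices Fin 3,
-- frozen vertices Fin f.

Vtx : ℕ → Set
Vtx f = Fin 3 ⊎ Fin f

_≟V_ : {f : ℕ} → DecidableEquality (Vtx f)
_≟V_ = ≡-dec FinP._≟_ FinP._≟_

frozenV : {f : ℕ} → Vtx f → Bool
frozenV (inj₁ _) = false
frozenV (inj₂ _) = true

mutPart : {f : ℕ} → Mat (Vtx f) → Mat (Fin 3)
mutPart b i j = b (inj₁ i) (inj₁ j)

Qseq : {f : ℕ} → Mat (Vtx f) → (ℕ → Fin 3) → ℕ → Mat (Vtx f)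
Qseq b m = iter _≟V_ b (λ n → inj₁ (m n))

count : Bool → ℕ
count true  = 1
count false = 0

AtMostOneFrozen : {V : Set} → (V → Bool) → V → V → V → Set
AtMostOneFrozen fr i j k = count (fr i) Data.Nat.+ count (fr j) Data.Nat.+ count (fr k) ≤ 1

-- the 3-vertex quiver on {i,j,k} is not acyclic, i.e. it contains a
-- directed cycle (which, absent loops and 2-cycles, is a directed 3-cycle)
NotAcyclic : {V : Set} → Mat V → V → V → V → Set
NotAcyclic b i j k =
  (0ℤ < b i j × 0ℤ < b j k × 0ℤ < b k i) ⊎ (0ℤ < b j i × 0ℤ < b k j × 0ℤ < b i k)

OrientedCycle : {V : Set} → (V → Bool) → Mat V → V → V → V → Set
OrientedCycle fr b i j k =
  i ≢ j × j ≢ k × i ≢ k × AtMostOneFrozen fr i j k × NotAcyclic b i j k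

CyclePreservingAt : {V : Set} → DecidableEquality V → (V → Bool) → Mat V → V → Set
CyclePreservingAt _≟_ fr b j =
  ∀ i k → OrientedCycle fr b i j k → OrientedCycle fr (μ _≟_ b j) i j k

-- the sequence m (m 0 = m_1, m 1 = m_2, ...) is cycle-preserving on b
CyclePreservingSeq : {V : Set} → DecidableEquality V → (V → Bool) → Mat V → (ℕ → V) → Set
CyclePreservingSeq _≟_ fr b m = ∀ n → CyclePreservingAt _≟_ fr (iter _≟_ b m n) (m n)

noFrozen : Fin 3 → Bool
noFrozen _ = false

Connected : {f : ℕ} → Mat (Vtx f) → Set
Connected {f} b =
  (∀ (i j : Fin 3) → Star (λ x y → mutPart b x y ≢ 0ℤ) i j)
  × (∀ (a : Fin f) → ∃[ k ] b (inj₂ a) (inj₁ k) ≢ 0ℤ)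

MutationAbundant : Mat (Fin 3) → Set
MutationAbundant b =
  ∀ (ks : List (Fin 3)) (i j : Fin 3) → i ≢ j → 2 ≤ ∣ mutList FinP._≟_ b ks i j ∣

Reduced : (ℕ → Fin 3) → Set
Reduced m = ∀ n → m n ≢ m (suc n)

WeaklyBalanced : (ℕ → Fin 3) → Set
WeaklyBalanced m = ∀ (k : Fin 3) (n : ℕ) → ∃[ n' ] (n ≤ n' × m n' ≡ k)

-- Fix a frozen vertex a and write c for its row of arrows to the three mutable vertices.
-- Abundance gives every mutable arrow weight at least 2, and cycle preservation on the
-- mutable part keeps a mutable 3-cycle cyclic, while a transitive mutable part stays
-- transitive, with the last mutated vertex as its sink, until its middle vertex is mutated
-- (reversing all arrows reduces a first mutation at the sink to this situation).  Relative
-- to the last mutated vertex l, call c settled if it has at most one nonzero entry, or if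
-- its entries on the cycle through l, resp. on the triangle with sink l, satisfy certain
-- sign and size conditions.  Mutating a settled row at any j ≢ l yields a settled row and
-- preserves every oriented 3-cycle through a and j.  Before c is settled, each mutation
-- settles it, leaves it unchanged (a zero pivot entry; two in a row make c sparse), or
-- strictly decreases the ℓ¹-norm of c (cyclic part) or the total size of its negative
-- entries (transitive part).  Hence every frozen row is eventually settled, and there are
-- only finitely many frozen vertices.

module Submission where

open import Defs
open import Data.Nat as ℕ using (ℕ; zero; suc; _≤′_)
import Data.Nat.Properties as ℕP
open import Data.Nat.Induction using (<-wellFounded)
open import Data.Integer as ℤ using (ℤ; +_; -[1+_]; _-_; _*_; -_; _⊔_; 0ℤ; 1ℤ; _<_; _≤_; ∣_∣; +≤+; +<+)
import Data.Integer.Properties as ℤP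
open import Data.Integer.Tactic.RingSolver using (solve-∀)
open import Data.Fin using (Fin; zero; suc)
import Data.Fin.Properties as FinP
open import Data.Vec using (lookup)
open import Data.List using ([]; _∷_; applyUpTo)
open import Data.Product using (Σ; ∃; ∃-syntax; _×_; _,_; proj₁; proj₂)
open import Data.Sum as Sum using (_⊎_; inj₁; inj₂)
open import Data.Sum.Properties using (inj₁-injective)
open import Data.Empty using (⊥; ⊥-elim)
open import Function using (_∘_; _on_; Injective)
open import Induction.WellFounded using (Acc; acc)
open import Algebra.Properties.CommutativeSemigroup ℕP.+-commutativeSemigroup using (xy∙z≈xz∙y)
open import Relation.Nullary using (¬_; Dec; yes; no; contradiction)
open import Relation.Nullary.Decidable using (_⊎-dec_)
open import Relation.Binary.Definitions using (DecidableEquality; tri<; tri≈; tri>)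
open import Relation.Binary.Construct.On using (wellFounded)
open import Relation.Binary.PropositionalEquality

0≤i*j : ∀ {i j} → 0ℤ ≤ i → 0ℤ ≤ j → 0ℤ ≤ i * j
0≤i*j {+ m} {+ n} _ _ = subst (0ℤ ≤_) (ℤP.pos-* m n) (+≤+ ℕ.z≤n)

-- Addition on ℤ is opened only locally: the statement of the theorem uses addition on ℕ.
module _ where
  open import Data.Integer using (_+_)

  private
    0≤i+j : ∀ {i j} → 0ℤ ≤ i → 0ℤ ≤ j → 0ℤ ≤ i + j
    0≤i+j = ℤP.+-mono-≤

    i<j⇒0≤j-i-1 : ∀ {i j} → i < j → 0ℤ ≤ j - i - 1ℤ
    i<j⇒0≤j-i-1 {i} {j} i<j = subst (0ℤ ≤_) (shift i j) (ℤP.i≤j⇒0≤j-i (ℤP.i<j⇒suc[i]≤j i<j))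
      where
      shift : ∀ i j → j - (1ℤ + i) ≡ j - i - 1ℤ
      shift = solve-∀

    ≤-by : ∀ {i j} d → 0ℤ ≤ d → j ≡ i + d → i ≤ j
    ≤-by {i} d 0≤d refl = subst (_≤ i + d) (ℤP.+-identityʳ i) (ℤP.+-monoʳ-≤ i 0≤d)

    <-by : ∀ {i j} d → 0ℤ ≤ d → j ≡ i + 1ℤ + d → i < j
    <-by {i} d 0≤d eq = ℤP.suc[i]≤j⇒i<j (≤-by d 0≤d (trans eq (cong (_+ d) (ℤP.+-comm i 1ℤ))))

    0<-i⇒i<0 : ∀ {i} → 0ℤ < - i → i < 0ℤ
    0<-i⇒i<0 {i} 0<-i = subst (_< 0ℤ) (ℤP.neg-involutive i) (ℤP.neg-mono-< 0<-i)

    undershoot : ∀ {x y k} → 0ℤ < x → + 2 ≤ k → y + x * k < x → x + y < y + x * k × x < - y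
    undershoot {x} {y} {k} 0<x 2≤k d<x =
        <-by _ (0≤i+j xk-2x (i<j⇒0≤j-i-1 0<x)) (expand₁ x y k)
      , <-by _ (0≤i+j (i<j⇒0≤j-i-1 d<x) xk-2x) (expand₂ x y k)
      where
      xk-2x : 0ℤ ≤ x * (k - + 2)
      xk-2x = 0≤i*j (ℤP.<⇒≤ 0<x) (ℤP.i≤j⇒0≤j-i 2≤k)
      expand₁ : ∀ x y k → y + x * k ≡ x + y + 1ℤ + (x * (k - + 2) + (x - 0ℤ - 1ℤ))
      expand₁ = solve-∀
      expand₂ : ∀ x y k → - y ≡ x + 1ℤ + ((x - (y + x * k) - 1ℤ) + x * (k - + 2))
      expand₂ = solve-∀

    ∣i∣<∣j∣ : ∀ {i j} → j < i → i < - j → ∣ i ∣ ℕ.< ∣ j ∣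
    ∣i∣<∣j∣ {+ m} { -[1+ n ]} _ (+<+ m<1+n) = m<1+n
    ∣i∣<∣j∣ { -[1+ m ]} { -[1+ n ]} (ℤ.-<- m<n) _ = ℕ.s≤s m<n
    ∣i∣<∣j∣ {+ m} {+ zero} _ (+<+ ())
    ∣i∣<∣j∣ {+ m} {+ suc n} _ ()
    ∣i∣<∣j∣ { -[1+ m ]} {+ n} () _

  0<i+j*k : ∀ {i j k} → 0ℤ < i → 0ℤ < j → 0ℤ < k → 0ℤ < i + j * k
  0<i+j*k 0<i 0<j 0<k = ℤP.<-≤-trans 0<i (≤-by _ (0≤i*j (ℤP.<⇒≤ 0<j) (ℤP.<⇒≤ 0<k)) refl)

  x≤y+x*k : ∀ {x y k} → 0ℤ < x → - x ≤ y → + 2 ≤ k → x ≤ y + x * k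
  x≤y+x*k {x} {y} {k} 0<x -x≤y 2≤k =
    ≤-by _ (0≤i+j (ℤP.i≤j⇒0≤j-i -x≤y) (0≤i*j (ℤP.<⇒≤ 0<x) (ℤP.i≤j⇒0≤j-i 2≤k))) (expand x y k)
    where
    expand : ∀ x y k → y + x * k ≡ x + ((y - - x) + x * (k - + 2))
    expand = solve-∀

  y+x*k≤x : ∀ {x y k} → x < 0ℤ → y ≤ - x → + 2 ≤ k → y + x * k ≤ x
  y+x*k≤x {x} {y} {k} x<0 y≤-x 2≤k =
    subst₂ _≤_ (negated y x k) (ℤP.neg-involutive x)
      (ℤP.neg-mono-≤ (x≤y+x*k (ℤP.neg-mono-< x<0) (ℤP.neg-mono-≤ y≤-x) 2≤k))
    where
    negated : ∀ y x k → - (- y + - x * k) ≡ y + x * k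
    negated = solve-∀

  ∣y+x*k∣<∣y∣ : ∀ {x y k} → 0ℤ < x → + 2 ≤ k → y + x * k < x → ∣ y + x * k ∣ ℕ.< ∣ y ∣
  ∣y+x*k∣<∣y∣ {x} {y} {k} 0<x 2≤k d<x with undershoot 0<x 2≤k d<x
  ... | x+y<d , x<-y = ∣i∣<∣j∣ (ℤP.<-trans y<x+y x+y<d) (ℤP.<-trans d<x x<-y)
    where
    y<x+y : y < x + y
    y<x+y = subst (_< x + y) (ℤP.+-identityˡ y) (ℤP.+-monoˡ-< y 0<x)

  ∣y+x*k∣<∣y∣′ : ∀ {x y k} → x < 0ℤ → + 2 ≤ k → x < y + x * k → ∣ y + x * k ∣ ℕ.< ∣ y ∣
  ∣y+x*k∣<∣y∣′ {x} {y} {k} x<0 2≤k x<d =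
    subst₂ ℕ._<_ (trans (cong ∣_∣ (negated x y k)) (ℤP.∣-i∣≡∣i∣ (y + x * k))) (ℤP.∣-i∣≡∣i∣ y)
      (∣y+x*k∣<∣y∣ { - x} { - y} (ℤP.neg-mono-< x<0) 2≤k
                   (subst (_< - x) (sym (negated x y k)) (ℤP.neg-mono-< x<d)))
    where
    negated : ∀ x y k → - y + - x * k ≡ - (y + x * k)
    negated = solve-∀

  negPart : ℤ → ℕ
  negPart (+ _) = 0
  negPart -[1+ n ] = suc n

  negPart-≥0 : ∀ {i} → 0ℤ ≤ i → negPart i ≡ 0
  negPart-≥0 (+≤+ _) = refl

  negPart[-i]≡∣i∣ : ∀ {i} → 0ℤ ≤ i → negPart (- i) ≡ ∣ i ∣
  negPart[-i]≡∣i∣ {+ zero} _ = refl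
  negPart[-i]≡∣i∣ {+ suc n} _ = refl

  0<negPart : ∀ {i} → i < 0ℤ → 0 ℕ.< negPart i
  0<negPart { -[1+ n ]} _ = ℕ.s≤s ℕ.z≤n
  0<negPart {+ n} (+<+ ())

  negPart-antimono : ∀ {i j} → i ≤ j → negPart j ℕ.≤ negPart i
  negPart-antimono {+ _} {+ _} _ = ℕ.z≤n
  negPart-antimono { -[1+ _ ]} {+ _} _ = ℕ.z≤n
  negPart-antimono { -[1+ m ]} { -[1+ n ]} (ℤ.-≤- n≤m) = ℕ.s≤s n≤m

  private
    +negPart≡- : ∀ {i} → i ≤ 0ℤ → + negPart i ≡ - i
    +negPart≡- { -[1+ n ]} _ = refl
    +negPart≡- {+ zero} _ = refl
    +negPart≡- {+ suc n} (+≤+ ())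

    negPart-shrink : ∀ {x y d} → 0ℤ < x → x + y < d → x < - y → negPart d ℕ.+ ∣ x ∣ ℕ.< negPart y
    negPart-shrink {x} {y} {+ n} 0<x _ x<-y =
      ℤP.drop‿+<+ (subst₂ _<_ (sym (ℤP.0≤i⇒+∣i∣≡i (ℤP.<⇒≤ 0<x))) (sym (+negPart≡- y≤0)) x<-y)
      where
      y≤0 : y ≤ 0ℤ
      y≤0 = ℤP.<⇒≤ (0<-i⇒i<0 (ℤP.<-trans 0<x x<-y))
    negPart-shrink {x} {y} { -[1+ n ]} 0<x x+y<d x<-y =
      ℤP.drop‿+<+ (subst₂ _<_ (sym lhs) (sym (+negPart≡- y≤0))
                            (<-by _ (i<j⇒0≤j-i-1 x+y<d) (expand x -[1+ n ] y)))
      where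
      y≤0 : y ≤ 0ℤ
      y≤0 = ℤP.<⇒≤ (0<-i⇒i<0 (ℤP.<-trans 0<x x<-y))
      lhs : + (suc n ℕ.+ ∣ x ∣) ≡ - -[1+ n ] + x
      lhs = trans (ℤP.pos-+ (suc n) ∣ x ∣)
                  (cong (λ z → - -[1+ n ] + z) (ℤP.0≤i⇒+∣i∣≡i (ℤP.<⇒≤ 0<x)))
      expand : ∀ x d y → - y ≡ - d + x + 1ℤ + (d - (x + y) - 1ℤ)
      expand = solve-∀

  negPart[y+x*k]+∣x∣<negPart[y] : ∀ {x y k} → 0ℤ < x → + 2 ≤ k → y + x * k < x
                                → negPart (y + x * k) ℕ.+ ∣ x ∣ ℕ.< negPart y
  negPart[y+x*k]+∣x∣<negPart[y] 0<x 2≤k d<x with undershoot 0<x 2≤k d<x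
  ... | x+y<d , x<-y = negPart-shrink 0<x x+y<d x<-y

i>0∧j≥0⇒-i≤j : ∀ {i j} → 0ℤ < i → 0ℤ ≤ j → - i ≤ j
i>0∧j≥0⇒-i≤j 0<i 0≤j = ℤP.≤-trans (ℤP.neg-mono-≤ (ℤP.<⇒≤ 0<i)) 0≤j

i≤0∧j<0⇒i≤-j : ∀ {i j} → i ≤ 0ℤ → j < 0ℤ → i ≤ - j
i≤0∧j<0⇒i≤-j i≤0 j<0 = ℤP.≤-trans i≤0 (ℤP.neg-mono-≤ (ℤP.<⇒≤ j<0))

-i≤j⇒-j≤i : ∀ {i j} → - i ≤ j → - j ≤ i
-i≤j⇒-j≤i {i} -i≤j = subst (_ ≤_) (ℤP.neg-involutive i) (ℤP.neg-mono-≤ -i≤j)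

0<i∧2≤∣i∣⇒2≤i : ∀ {i} → 0ℤ < i → 2 ℕ.≤ ∣ i ∣ → + 2 ≤ i
0<i∧2≤∣i∣⇒2≤i {+ n} _ 2≤n = +≤+ 2≤n

module _ where
  open import Data.Integer using (_+_)

  mutate : ℤ → ℤ → ℤ → ℤ
  mutate x p q = x + (p ⊔ 0ℤ) * (q ⊔ 0ℤ) - ((- p) ⊔ 0ℤ) * ((- q) ⊔ 0ℤ)

  module _ (x : ℤ) {p q : ℤ} where

    private
      mutate-by : ∀ {P Q R S} → p ⊔ 0ℤ ≡ P → q ⊔ 0ℤ ≡ Q → (- p) ⊔ 0ℤ ≡ R → (- q) ⊔ 0ℤ ≡ S
                → mutate x p q ≡ x + P * Q - R * S
      mutate-by refl refl refl refl = refl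

      ⊔0-≥0 : ∀ {i} → 0ℤ ≤ i → i ⊔ 0ℤ ≡ i
      ⊔0-≥0 = ℤP.i≥j⇒i⊔j≡i

      ⊔0-≤0 : ∀ {i} → i ≤ 0ℤ → i ⊔ 0ℤ ≡ 0ℤ
      ⊔0-≤0 = ℤP.i≤j⇒i⊔j≡j

    mutate-≥0-≥0 : 0ℤ ≤ p → 0ℤ ≤ q → mutate x p q ≡ x + p * q
    mutate-≥0-≥0 0≤p 0≤q =
      trans (mutate-by (⊔0-≥0 0≤p) (⊔0-≥0 0≤q)
                       (⊔0-≤0 (ℤP.neg-mono-≤ 0≤p)) (⊔0-≤0 (ℤP.neg-mono-≤ 0≤q)))
            (simplify x p q)
      where
      simplify : ∀ x p q → x + p * q - 0ℤ * 0ℤ ≡ x + p * q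
      simplify = solve-∀

    mutate-≤0-≤0 : p ≤ 0ℤ → q ≤ 0ℤ → mutate x p q ≡ x - p * q
    mutate-≤0-≤0 p≤0 q≤0 =
      trans (mutate-by (⊔0-≤0 p≤0) (⊔0-≤0 q≤0)
                       (⊔0-≥0 (ℤP.neg-mono-≤ p≤0)) (⊔0-≥0 (ℤP.neg-mono-≤ q≤0)))
            (simplify x p q)
      where
      simplify : ∀ x p q → x + 0ℤ * 0ℤ - (- p) * (- q) ≡ x - p * q
      simplify = solve-∀

    mutate-≥0-≤0 : 0ℤ ≤ p → q ≤ 0ℤ → mutate x p q ≡ x
    mutate-≥0-≤0 0≤p q≤0 =
      trans (mutate-by (⊔0-≥0 0≤p) (⊔0-≤0 q≤0)
                       (⊔0-≤0 (ℤP.neg-mono-≤ 0≤p)) (⊔0-≥0 (ℤP.neg-mono-≤ q≤0)))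
            (simplify x p q)
      where
      simplify : ∀ x p q → x + p * 0ℤ - 0ℤ * (- q) ≡ x
      simplify = solve-∀

    mutate-≤0-≥0 : p ≤ 0ℤ → 0ℤ ≤ q → mutate x p q ≡ x
    mutate-≤0-≥0 p≤0 0≤q =
      trans (mutate-by (⊔0-≤0 p≤0) (⊔0-≥0 0≤q)
                       (⊔0-≥0 (ℤP.neg-mono-≤ p≤0)) (⊔0-≤0 (ℤP.neg-mono-≤ 0≤q)))
            (simplify x p q)
      where
      simplify : ∀ x p q → x + 0ℤ * q - (- p) * 0ℤ ≡ x
      simplify = solve-∀

  mutate-0 : ∀ x q → mutate x 0ℤ q ≡ x
  mutate-0 x q = simplify x (q ⊔ 0ℤ) ((- q) ⊔ 0ℤ)
    where
    simplify : ∀ x Q S → x + 0ℤ * Q - 0ℤ * S ≡ x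
    simplify = solve-∀

  mutate-transpose : ∀ x p q → mutate (- x) (- q) (- p) ≡ - mutate x p q
  mutate-transpose x p q rewrite ℤP.neg-involutive p | ℤP.neg-involutive q =
    regroup x (p ⊔ 0ℤ) (q ⊔ 0ℤ) ((- p) ⊔ 0ℤ) ((- q) ⊔ 0ℤ)
    where
    regroup : ∀ x P Q R S → - x + S * R - Q * P ≡ - (x + P * Q - R * S)
    regroup = solve-∀

  mutate-negate : ∀ x p q → mutate (- x) (- p) (- q) ≡ - mutate x p q
  mutate-negate x p q rewrite ℤP.neg-involutive p | ℤP.neg-involutive q =
    regroup x (p ⊔ 0ℤ) (q ⊔ 0ℤ) ((- p) ⊔ 0ℤ) ((- q) ⊔ 0ℤ)
    where
    regroup : ∀ x P Q R S → - x + R * S - P * Q ≡ - (x + P * Q - R * S)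
    regroup = solve-∀

_≐_ : {V : Set} → Mat V → Mat V → Set
b ≐ b′ = ∀ x y → b x y ≡ b′ x y

negate : {V : Set} → Mat V → Mat V
negate b x y = - b x y

restrict : {V W : Set} → (W → V) → Mat V → Mat W
restrict φ b x y = b (φ x) (φ y)

module _ {V : Set} (_≟_ : DecidableEquality V) where

  μ-pivot : ∀ (b : Mat V) {k x y} → x ≡ k ⊎ y ≡ k → μ _≟_ b k x y ≡ - b x y
  μ-pivot b {k} {x} {y} touches with x ≟ k | y ≟ k
  ... | yes _ | _ = refl
  ... | no _ | yes _ = refl
  ... | no x≢k | no y≢k = ⊥-elim (Sum.[ x≢k , y≢k ] touches)

  μ-away : ∀ (b : Mat V) {k x y} → ¬ (x ≡ k ⊎ y ≡ k) → μ _≟_ b k x y ≡ mutate (b x y) (b x k) (b k y)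
  μ-away b {k} {x} {y} avoids with x ≟ k | y ≟ k
  ... | yes x≡k | _ = ⊥-elim (avoids (inj₁ x≡k))
  ... | no _ | yes y≡k = ⊥-elim (avoids (inj₂ y≡k))
  ... | no _ | no _ = refl

  μ-cong : ∀ {b b′ : Mat V} → b ≐ b′ → ∀ k → μ _≟_ b k ≐ μ _≟_ b′ k
  μ-cong {b} {b′} b≐b′ k x y with (x ≟ k) ⊎-dec (y ≟ k)
  ... | yes t = trans (μ-pivot b t) (trans (cong -_ (b≐b′ x y)) (sym (μ-pivot b′ t)))
  ... | no ¬t = trans (μ-away b ¬t)
                  (trans (cong₂ (λ u v → mutate u v (b k y)) (b≐b′ x y) (b≐b′ x k))
                    (trans (cong (mutate (b′ x y) (b′ x k)) (b≐b′ k y)) (sym (μ-away b′ ¬t))))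

  μ-skew : ∀ {b : Mat V} → Skew b → ∀ k → Skew (μ _≟_ b k)
  μ-skew {b} sk k x y with (x ≟ k) ⊎-dec (y ≟ k)
  ... | yes t = trans (μ-pivot b (Sum.swap t)) (trans (cong -_ (sk x y)) (cong -_ (sym (μ-pivot b t))))
  ... | no ¬t = begin
    μ _≟_ b k y x                           ≡⟨ μ-away b (¬t ∘ Sum.swap) ⟩
    mutate (b y x) (b y k) (b k x)          ≡⟨ cong₂ (λ u v → mutate u v (b k x)) (sk x y) (sk k y) ⟩
    mutate (- b x y) (- b k y) (b k x)      ≡⟨ cong (mutate (- b x y) (- b k y)) (sk x k) ⟩
    mutate (- b x y) (- b k y) (- b x k)    ≡⟨ mutate-transpose (b x y) (b x k) (b k y) ⟩
    - mutate (b x y) (b x k) (b k y)        ≡⟨ cong -_ (sym (μ-away b ¬t)) ⟩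
    - μ _≟_ b k x y                         ∎
    where open ≡-Reasoning

  μ-negate : ∀ (b : Mat V) k → μ _≟_ (negate b) k ≐ negate (μ _≟_ b k)
  μ-negate b k x y with (x ≟ k) ⊎-dec (y ≟ k)
  ... | yes t = trans (μ-pivot (negate b) t) (cong -_ (sym (μ-pivot b t)))
  ... | no ¬t = trans (μ-away (negate b) ¬t)
                  (trans (mutate-negate (b x y) (b x k) (b k y)) (cong -_ (sym (μ-away b ¬t))))

  iter-skew : ∀ {b : Mat V} → Skew b → ∀ m n → Skew (iter _≟_ b m n)
  iter-skew sk m zero = sk
  iter-skew sk m (suc n) = μ-skew (iter-skew sk m n) (m n)

  iter-negate : ∀ (b : Mat V) m n → iter _≟_ (negate b) m n ≐ negate (iter _≟_ b m n)
  iter-negate b m zero _ _ = refl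
  iter-negate b m (suc n) x y =
    trans (μ-cong (iter-negate b m n) (m n) x y) (μ-negate (iter _≟_ b m n) (m n) x y)

  iter-+ : ∀ (b : Mat V) m s n → iter _≟_ b m (s ℕ.+ n) ≡ iter _≟_ (iter _≟_ b m s) (λ k → m (s ℕ.+ k)) n
  iter-+ b m s zero = cong (iter _≟_ b m) (ℕP.+-identityʳ s)
  iter-+ b m s (suc n) =
    trans (cong (iter _≟_ b m) (ℕP.+-suc s n)) (cong (λ c → μ _≟_ c (m (s ℕ.+ n))) (iter-+ b m s n))

  iter≡mutList : ∀ (b : Mat V) m n → iter _≟_ b m n ≡ mutList _≟_ b (applyUpTo m n)
  iter≡mutList b m zero = refl
  iter≡mutList b m (suc n) = trans (iter-+ b m 1 n) (iter≡mutList (μ _≟_ b (m 0)) (m ∘ suc) n)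

  mutList-cong : ∀ {b b′ : Mat V} → b ≐ b′ → ∀ ks → mutList _≟_ b ks ≐ mutList _≟_ b′ ks
  mutList-cong b≐b′ [] = b≐b′
  mutList-cong b≐b′ (k ∷ ks) = mutList-cong (μ-cong b≐b′ k) ks

  mutList-negate : ∀ (b : Mat V) ks → mutList _≟_ (negate b) ks ≐ negate (mutList _≟_ b ks)
  mutList-negate b [] _ _ = refl
  mutList-negate b (k ∷ ks) x y =
    trans (mutList-cong (μ-negate b k) ks x y) (mutList-negate (μ _≟_ b k) ks x y)

module _ {V W : Set} (_≟ⱽ_ : DecidableEquality V) (_≟ᵂ_ : DecidableEquality W)
         {φ : W → V} (φ-injective : Injective _≡_ _≡_ φ) where

  μ-restrict : ∀ (b : Mat V) k → μ _≟ᵂ_ (restrict φ b) k ≐ restrict φ (μ _≟ⱽ_ b (φ k))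
  μ-restrict b k x y with (x ≟ᵂ k) ⊎-dec (y ≟ᵂ k)
  ... | yes t = trans (μ-pivot _≟ᵂ_ (restrict φ b) t) (sym (μ-pivot _≟ⱽ_ b (Sum.map (cong φ) (cong φ) t)))
  ... | no ¬t = trans (μ-away _≟ᵂ_ (restrict φ b) ¬t)
                  (sym (μ-away _≟ⱽ_ b (¬t ∘ Sum.map φ-injective φ-injective)))

  iter-restrict : ∀ (b : Mat V) m n → iter _≟ᵂ_ (restrict φ b) m n ≐ restrict φ (iter _≟ⱽ_ b (φ ∘ m) n)
  iter-restrict b m zero _ _ = refl
  iter-restrict b m (suc n) x y =
    trans (μ-cong _≟ᵂ_ (iter-restrict b m n) (m n) x y) (μ-restrict (iter _≟ⱽ_ b (φ ∘ m) n) (m n) x y)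

-- Arrows, 3-cycles and transitive triangles

i≡-i⇒i≡0 : ∀ {i} → i ≡ - i → i ≡ 0ℤ
i≡-i⇒i≡0 {+ zero} _ = refl

Heavy : {V : Set} → Mat V → Set
Heavy b = ∀ x y → 0ℤ < b x y → + 2 ≤ b x y

Cyclic : {V : Set} → Mat V → V → V → V → Set
Cyclic b x y z = 0ℤ < b x y × 0ℤ < b y z × 0ℤ < b z x

Transitive : {V : Set} → Mat V → V → V → V → Set
Transitive b s m t = 0ℤ < b s m × 0ℤ < b m t × 0ℤ < b s t

Cyclic-rotate : ∀ {V} {b : Mat V} {x y z} → Cyclic b x y z → Cyclic b y z x
Cyclic-rotate (xy , yz , zx) = yz , zx , xy

module _ {V : Set} {b : Mat V} (sk : Skew b) where

  arrow⇒≢ : ∀ {x y} → 0ℤ < b x y → x ≢ y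
  arrow⇒≢ {x} 0<bxy refl = ℤP.<-irrefl (sym (i≡-i⇒i≡0 (sk x x))) 0<bxy

  arrow-reverse : ∀ {x y} → 0ℤ < b x y → b y x < 0ℤ
  arrow-reverse {x} {y} 0<bxy = subst (_< 0ℤ) (sym (sk x y)) (ℤP.neg-mono-< 0<bxy)

  arrow-reverse⁻¹ : ∀ {x y} → b y x < 0ℤ → 0ℤ < b x y
  arrow-reverse⁻¹ {x} {y} byx<0 =
    subst (0ℤ <_) (trans (cong -_ (sk x y)) (ℤP.neg-involutive (b x y))) (ℤP.neg-mono-< byx<0)

  negate-skew : Skew (negate b)
  negate-skew x y = cong -_ (sk x y)

  Transitive-negate : ∀ {s m t} → Transitive b s m t → Transitive (negate b) t m s
  Transitive-negate (sm , mt , st) =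
    ℤP.neg-mono-< (arrow-reverse mt) , ℤP.neg-mono-< (arrow-reverse sm) , ℤP.neg-mono-< (arrow-reverse st)

  module _ (_≟_ : DecidableEquality V) where

    μ-reverse : ∀ {k x y} → 0ℤ < b x y → x ≡ k ⊎ y ≡ k → 0ℤ < μ _≟_ b k y x
    μ-reverse {x = x} {y} 0<bxy touches =
      subst (0ℤ <_) (sym (trans (μ-pivot _≟_ b (Sum.swap touches))
                               (trans (cong -_ (sk x y)) (ℤP.neg-involutive (b x y))))) 0<bxy

    Transitive⇒Cyclic-μ-middle : ∀ {s m t} → Transitive b s m t → Cyclic (μ _≟_ b m) m s t
    Transitive⇒Cyclic-μ-middle {s} {m} {t} (sm , mt , st) =
        μ-reverse sm (inj₂ refl)
      , subst (0ℤ <_) (sym (trans (μ-away _≟_ b Sum.[ arrow⇒≢ sm , arrow⇒≢ mt ∘ sym ])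
                                  (mutate-≥0-≥0 (b s t) (ℤP.<⇒≤ sm) (ℤP.<⇒≤ mt))))
                      (0<i+j*k st sm mt)
      , μ-reverse mt (inj₁ refl)

    Transitive-μ-source : ∀ {s m t} → Transitive b s m t → Transitive (μ _≟_ b s) m t s
    Transitive-μ-source {s} {m} {t} (sm , mt , st) =
        subst (0ℤ <_) (sym unchanged) mt
      , μ-reverse st (inj₁ refl)
      , μ-reverse sm (inj₁ refl)
      where
      unchanged : μ _≟_ b s m t ≡ b m t
      unchanged = trans (μ-away _≟_ b Sum.[ arrow⇒≢ sm ∘ sym , arrow⇒≢ st ∘ sym ])
                        (mutate-≤0-≥0 (b m t) (ℤP.<⇒≤ (arrow-reverse sm)) (ℤP.<⇒≤ st))

module _ {V : Set} where

  NotAcyclic-swap : ∀ {b : Mat V} {i j k} → NotAcyclic b i j k → NotAcyclic b k j i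
  NotAcyclic-swap (inj₁ (ij , jk , ki)) = inj₂ (jk , ij , ki)
  NotAcyclic-swap (inj₂ (ji , kj , ik)) = inj₁ (kj , ji , ik)

  NotAcyclic-transpose : ∀ {b b′ : Mat V} → (∀ x y → b′ x y ≡ b y x)
                       → ∀ {i j k} → NotAcyclic b i j k → NotAcyclic b′ i j k
  NotAcyclic-transpose t {i} {j} {k} (inj₁ (ij , jk , ki)) =
    inj₂ (subst (0ℤ <_) (sym (t j i)) ij , subst (0ℤ <_) (sym (t k j)) jk , subst (0ℤ <_) (sym (t i k)) ki)
  NotAcyclic-transpose t {i} {j} {k} (inj₂ (ji , kj , ik)) =
    inj₁ (subst (0ℤ <_) (sym (t i j)) ji , subst (0ℤ <_) (sym (t j k)) kj , subst (0ℤ <_) (sym (t k i)) ik)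

  OrientedCycle-transpose : ∀ {fr} {b b′ : Mat V} → (∀ x y → b′ x y ≡ b y x)
                          → ∀ {i j k} → OrientedCycle fr b i j k → OrientedCycle fr b′ i j k
  OrientedCycle-transpose t (i≢j , j≢k , i≢k , frozen , cyc) =
    i≢j , j≢k , i≢k , frozen , NotAcyclic-transpose t cyc

  OrientedCycle-≐ : ∀ {fr} {b b′ : Mat V} → b ≐ b′
                  → ∀ {i j k} → OrientedCycle fr b i j k → OrientedCycle fr b′ i j k
  OrientedCycle-≐ {b = b} {b′} b≐b′ (i≢j , j≢k , i≢k , frozen , cyc) =
    i≢j , j≢k , i≢k , frozen , transport cyc
    where
    arrow : ∀ {x y} → 0ℤ < b x y → 0ℤ < b′ x y
    arrow {x} {y} = subst (0ℤ <_) (b≐b′ x y)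
    transport : ∀ {i j k} → NotAcyclic b i j k → NotAcyclic b′ i j k
    transport (inj₁ (ij , jk , ki)) = inj₁ (arrow ij , arrow jk , arrow ki)
    transport (inj₂ (ji , kj , ik)) = inj₂ (arrow ji , arrow kj , arrow ik)

  CyclePreservingAt-reverse : ∀ (_≟_ : DecidableEquality V) fr {b b′ : Mat V} → Skew b → b′ ≐ negate b
                            → ∀ {k} → CyclePreservingAt _≟_ fr b′ k → CyclePreservingAt _≟_ fr b k
  CyclePreservingAt-reverse _≟_ fr {b} {b′} sk b′≐-b {k} preserves i j =
    OrientedCycle-transpose {fr} μ-transposed ∘ preserves i j ∘ OrientedCycle-transpose {fr} transposed
    where
    transposed : ∀ x y → b′ x y ≡ b y x
    transposed x y = trans (b′≐-b x y) (sym (sk x y))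
    μ-transposed : ∀ x y → μ _≟_ b k x y ≡ μ _≟_ b′ k y x
    μ-transposed x y = begin
      μ _≟_ b k x y               ≡⟨ μ-skew _≟_ sk k y x ⟩
      - μ _≟_ b k y x             ≡⟨ μ-negate _≟_ b k y x ⟨
      μ _≟_ (negate b) k y x      ≡⟨ μ-cong _≟_ b′≐-b k y x ⟨
      μ _≟_ b′ k y x              ∎
      where open ≡-Reasoning

no-four-distinct : ∀ {x y z v : Fin 3} → x ≢ y → x ≢ z → x ≢ v → y ≢ z → y ≢ v → z ≢ v → ⊥
no-four-distinct {x} {y} {z} {v} x≢y x≢z x≢v y≢z y≢v z≢v =
  contradiction (FinP.injective⇒≤ distinct) (ℕP.<⇒≱ (ℕP.n<1+n 3))
  where
  open import Data.Vec using (_∷_; [])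
  distinct : ∀ {i j} → lookup (x ∷ y ∷ z ∷ v ∷ []) i ≡ lookup (x ∷ y ∷ z ∷ v ∷ []) j → i ≡ j
  distinct {zero} {zero} _ = refl
  distinct {zero} {suc zero} e = contradiction e x≢y
  distinct {zero} {suc (suc zero)} e = contradiction e x≢z
  distinct {zero} {suc (suc (suc zero))} e = contradiction e x≢v
  distinct {suc zero} {zero} e = contradiction (sym e) x≢y
  distinct {suc zero} {suc zero} _ = refl
  distinct {suc zero} {suc (suc zero)} e = contradiction e y≢z
  distinct {suc zero} {suc (suc (suc zero))} e = contradiction e y≢v
  distinct {suc (suc zero)} {zero} e = contradiction (sym e) x≢z
  distinct {suc (suc zero)} {suc zero} e = contradiction (sym e) y≢z
  distinct {suc (suc zero)} {suc (suc zero)} _ = refl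
  distinct {suc (suc zero)} {suc (suc (suc zero))} e = contradiction e z≢v
  distinct {suc (suc (suc zero))} {zero} e = contradiction (sym e) x≢v
  distinct {suc (suc (suc zero))} {suc zero} e = contradiction (sym e) y≢v
  distinct {suc (suc (suc zero))} {suc (suc zero)} e = contradiction (sym e) z≢v
  distinct {suc (suc (suc zero))} {suc (suc (suc zero))} _ = refl

Fin3-cover : ∀ {x y z : Fin 3} → x ≢ y → y ≢ z → x ≢ z → ∀ v → v ≡ x ⊎ v ≡ y ⊎ v ≡ z
Fin3-cover {x} {y} {z} x≢y y≢z x≢z v with v FinP.≟ x | v FinP.≟ y | v FinP.≟ z
... | yes v≡x | _ | _ = inj₁ v≡x
... | no _ | yes v≡y | _ = inj₂ (inj₁ v≡y)
... | no _ | no _ | yes v≡z = inj₂ (inj₂ v≡z)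
... | no v≢x | no v≢y | no v≢z =
  ⊥-elim (no-four-distinct x≢y x≢z (v≢x ∘ sym) y≢z (v≢y ∘ sym) (v≢z ∘ sym))

module _ {M : Mat (Fin 3)} (sk : Skew M) where

  Cyclic-cover : ∀ {x y z} → Cyclic M x y z → ∀ v → v ≡ x ⊎ v ≡ y ⊎ v ≡ z
  Cyclic-cover (xy , yz , zx) = Fin3-cover (arrow⇒≢ sk xy) (arrow⇒≢ sk yz) (arrow⇒≢ sk zx ∘ sym)

  Transitive-cover : ∀ {s m t} → Transitive M s m t → ∀ v → v ≡ s ⊎ v ≡ m ⊎ v ≡ t
  Transitive-cover (sm , mt , st) = Fin3-cover (arrow⇒≢ sk sm) (arrow⇒≢ sk mt) (arrow⇒≢ sk st)

  Cyclic-through : ∀ {x y z} → Cyclic M x y z → ∀ j → Σ (Fin 3) λ o → Σ (Fin 3) λ i → Cyclic M j o i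
  Cyclic-through {x} {y} {z} cyc j with Cyclic-cover cyc j
  ... | inj₁ refl = y , z , cyc
  ... | inj₂ (inj₁ refl) = z , x , Cyclic-rotate {b = M} cyc
  ... | inj₂ (inj₂ refl) = x , y , Cyclic-rotate {b = M} (Cyclic-rotate {b = M} cyc)

  tournament : (∀ u v → u ≢ v → M u v ≢ 0ℤ)
             → (Σ (Fin 3) λ x → Σ (Fin 3) λ y → Σ (Fin 3) λ z → Cyclic M x y z)
             ⊎ (Σ (Fin 3) λ s → Σ (Fin 3) λ m → Σ (Fin 3) λ t → Transitive M s m t)
  tournament nonzero with arrow 0F 1F (λ ()) | arrow 1F 2F (λ ()) | arrow 0F 2F (λ ())
    where
    0F 1F 2F : Fin 3
    0F = zero
    1F = suc zero
    2F = suc (suc zero)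
    arrow : ∀ u v → u ≢ v → 0ℤ < M u v ⊎ 0ℤ < M v u
    arrow u v u≢v with ℤP.<-cmp 0ℤ (M u v)
    ... | tri< 0<Muv _ _ = inj₁ 0<Muv
    ... | tri≈ _ 0≡Muv _ = ⊥-elim (nonzero u v u≢v (sym 0≡Muv))
    ... | tri> _ _ Muv<0 = inj₂ (arrow-reverse⁻¹ sk Muv<0)
  ... | inj₁ a01 | inj₁ a12 | inj₁ a02 = inj₂ (_ , _ , _ , a01 , a12 , a02)
  ... | inj₁ a01 | inj₁ a12 | inj₂ a20 = inj₁ (_ , _ , _ , a01 , a12 , a20)
  ... | inj₁ a01 | inj₂ a21 | inj₁ a02 = inj₂ (_ , _ , _ , a02 , a21 , a01)
  ... | inj₁ a01 | inj₂ a21 | inj₂ a20 = inj₂ (_ , _ , _ , a20 , a01 , a21)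
  ... | inj₂ a10 | inj₁ a12 | inj₁ a02 = inj₂ (_ , _ , _ , a10 , a02 , a12)
  ... | inj₂ a10 | inj₁ a12 | inj₂ a20 = inj₂ (_ , _ , _ , a12 , a20 , a10)
  ... | inj₂ a10 | inj₂ a21 | inj₁ a02 = inj₁ (_ , _ , _ , a02 , a21 , a10)
  ... | inj₂ a10 | inj₂ a21 | inj₂ a20 = inj₂ (_ , _ , _ , a21 , a10 , a20)

norm₁ : (Fin 3 → ℤ) → ℕ
norm₁ c = ∣ c zero ∣ ℕ.+ ∣ c (suc zero) ∣ ℕ.+ ∣ c (suc (suc zero)) ∣

norm₁-< : ∀ {c c′ : Fin 3 → ℤ} → (∀ v → ∣ c′ v ∣ ℕ.≤ ∣ c v ∣)
        → ∀ w → ∣ c′ w ∣ ℕ.< ∣ c w ∣ → norm₁ c′ ℕ.< norm₁ c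
norm₁-< le zero lt = ℕP.+-mono-<-≤ (ℕP.+-mono-<-≤ lt (le _)) (le _)
norm₁-< le (suc zero) lt = ℕP.+-mono-<-≤ (ℕP.+-mono-≤-< (le _) lt) (le _)
norm₁-< le (suc (suc zero)) lt = ℕP.+-mono-≤-< (ℕP.+-mono-≤ (le _) (le _)) lt

norm₁-cong : ∀ {c c′ : Fin 3 → ℤ} → (∀ v → c′ v ≡ c v) → norm₁ c′ ≡ norm₁ c
norm₁-cong same = cong₂ ℕ._+_ (cong₂ ℕ._+_ (cong ∣_∣ (same _)) (cong ∣_∣ (same _))) (cong ∣_∣ (same _))

-- The row of a frozen vertex

Sparse : (Fin 3 → ℤ) → Set
Sparse c = Σ (Fin 3) λ x → Σ (Fin 3) λ y → x ≢ y × c x ≡ 0ℤ × c y ≡ 0ℤ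

Sparse-rest : ∀ {c} → Sparse c → ∀ {j} → c j ≢ 0ℤ → ∀ u → u ≢ j → c u ≡ 0ℤ
Sparse-rest {c} (x , y , x≢y , cx≡0 , cy≡0) {j} cj≢0 u u≢j
  with Fin3-cover x≢y (λ y≡j → cj≢0 (subst (λ v → c v ≡ 0ℤ) y≡j cy≡0))
                      (λ x≡j → cj≢0 (subst (λ v → c v ≡ 0ℤ) x≡j cx≡0)) u
... | inj₁ refl = cx≡0
... | inj₂ (inj₁ refl) = cy≡0
... | inj₂ (inj₂ u≡j) = contradiction u≡j u≢j

Sparse-transfer : ∀ {c c′} → Sparse c → (∀ v → c v ≡ 0ℤ → c′ v ≡ 0ℤ) → Sparse c′
Sparse-transfer (x , y , x≢y , cx≡0 , cy≡0) zeros = x , y , x≢y , zeros x cx≡0 , zeros y cy≡0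

data CycleCompatible (x y z : ℤ) : Set where
  positive  : 0ℤ < x → y < 0ℤ → x ≤ - y → CycleCompatible x y z
  negative  : x < 0ℤ → 0ℤ < z → - x ≤ z → CycleCompatible x y z
  vanishing : x ≡ 0ℤ → y < 0ℤ → 0ℤ < z → CycleCompatible x y z

SinkCompatible : ℤ → ℤ → ℤ → Set
SinkCompatible x y z = 0ℤ < x × 0ℤ < y × z ≤ 0ℤ × - z ≤ x × - z ≤ y

data CycleReady (c : Fin 3 → ℤ) (j o i : Fin 3) : Set where
  ready⁺ : 0ℤ < c j → - c j ≤ c o → CycleReady c j o i
  ready⁻ : c j < 0ℤ → c i ≤ - c j → CycleReady c j o i
  ready⁰ : c j ≡ 0ℤ → c i < 0ℤ → 0ℤ < c o → CycleReady c j o i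

module _ {c : Fin 3 → ℤ} where

  ready-by-sign : ∀ {j o i} → (0ℤ < c j → - c j ≤ c o) → (c j < 0ℤ → c i ≤ - c j)
                → (c j ≡ 0ℤ → c i < 0ℤ × 0ℤ < c o) → CycleReady c j o i
  ready-by-sign {j} pos neg zer with ℤP.<-cmp 0ℤ (c j)
  ... | tri< 0<cj _ _ = ready⁺ 0<cj (pos 0<cj)
  ... | tri≈ _ 0≡cj _ = ready⁰ (sym 0≡cj) (proj₁ (zer (sym 0≡cj))) (proj₂ (zer (sym 0≡cj)))
  ... | tri> _ _ cj<0 = ready⁻ cj<0 (neg cj<0)

  ready-sparse : ∀ {j o i} → c j ≢ 0ℤ → c o ≡ 0ℤ → c i ≡ 0ℤ → CycleReady c j o i
  ready-sparse cj≢0 co≡0 ci≡0 =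
    ready-by-sign (λ 0<cj → i>0∧j≥0⇒-i≤j 0<cj (ℤP.≤-reflexive (sym co≡0)))
                  (λ cj<0 → i≤0∧j<0⇒i≤-j (ℤP.≤-reflexive ci≡0) cj<0)
                  (⊥-elim ∘ cj≢0)

  ready-after-first : ∀ {l p q} → CycleCompatible (c l) (c p) (c q) → CycleReady c p q l
  ready-after-first (positive _ cp<0 cl≤-cp) = ready⁻ cp<0 cl≤-cp
  ready-after-first (negative cl<0 0<cq _) =
    ready-by-sign (λ 0<cp → i>0∧j≥0⇒-i≤j 0<cp (ℤP.<⇒≤ 0<cq))
                  (λ cp<0 → i≤0∧j<0⇒i≤-j (ℤP.<⇒≤ cl<0) cp<0)
                  (λ _ → cl<0 , 0<cq)
  ready-after-first (vanishing cl≡0 cp<0 _) = ready⁻ cp<0 (i≤0∧j<0⇒i≤-j (ℤP.≤-reflexive cl≡0) cp<0)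

  ready-before-first : ∀ {l p q} → CycleCompatible (c l) (c p) (c q) → CycleReady c q l p
  ready-before-first (positive 0<cl cp<0 _) =
    ready-by-sign (λ 0<cq → i>0∧j≥0⇒-i≤j 0<cq (ℤP.<⇒≤ 0<cl))
                  (λ cq<0 → i≤0∧j<0⇒i≤-j (ℤP.<⇒≤ cp<0) cq<0)
                  (λ _ → cp<0 , 0<cl)
  ready-before-first (negative _ 0<cq -cl≤cq) = ready⁺ 0<cq (-i≤j⇒-j≤i -cl≤cq)
  ready-before-first (vanishing cl≡0 _ 0<cq) = ready⁺ 0<cq (i>0∧j≥0⇒-i≤j 0<cq (ℤP.≤-reflexive (sym cl≡0)))

negMass : (Fin 3 → ℤ) → Fin 3 → Fin 3 → Fin 3 → ℕ
negMass c x y z = negPart (c x) ℕ.+ negPart (c y) ℕ.+ negPart (c z)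

negMass-cong : ∀ {c c′ : Fin 3 → ℤ} → (∀ v → c′ v ≡ c v)
             → ∀ x y z → negMass c′ x y z ≡ negMass c x y z
negMass-cong same x y z =
  cong₂ ℕ._+_ (cong₂ ℕ._+_ (cong negPart (same x)) (cong negPart (same y))) (cong negPart (same z))

negMass-rotate : ∀ c x y z → negMass c y z x ≡ negMass c x y z
negMass-rotate c x y z = trans (ℕP.+-comm (negPart (c y) ℕ.+ negPart (c z)) (negPart (c x)))
                               (sym (ℕP.+-assoc (negPart (c x)) (negPart (c y)) (negPart (c z))))

module _ {f : ℕ} where
  open import Data.Integer using (_+_)

  μ₁ : Mat (Vtx f) → Fin 3 → Mat (Vtx f)
  μ₁ B j = μ _≟V_ B (inj₁ j)

  row : Mat (Vtx f) → Fin f → Fin 3 → ℤ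
  row B a v = B (inj₂ a) (inj₁ v)

  row-pivot : ∀ B a j → row (μ₁ B j) a j ≡ - row B a j
  row-pivot B a j = μ-pivot _≟V_ B (inj₂ refl)

  row-away : ∀ B a {j v} → v ≢ j → row (μ₁ B j) a v ≡ mutate (row B a v) (row B a j) (mutPart B j v)
  row-away B a v≢j = μ-away _≟V_ B Sum.[ (λ ()) , v≢j ∘ inj₁-injective ]

  PreservesFrozenCycles : Mat (Vtx f) → Fin 3 → Fin f → Set
  PreservesFrozenCycles B j a =
    ∀ i → NotAcyclic B (inj₂ a) (inj₁ j) (inj₁ i) → NotAcyclic (μ₁ B j) (inj₂ a) (inj₁ j) (inj₁ i)

  preserves-frozen-cycles :
    ∀ {B} → Skew B → ∀ {j a}
    → (0ℤ < row B a j → ∀ i → 0ℤ < mutPart B j i → row B a i < 0ℤ → 0ℤ < row (μ₁ B j) a i)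
    → (row B a j < 0ℤ → ∀ i → 0ℤ < mutPart B i j → 0ℤ < row B a i → row (μ₁ B j) a i < 0ℤ)
    → PreservesFrozenCycles B j a
  preserves-frozen-cycles {B} sk {j} {a} out-neighbours in-neighbours i (inj₁ (a→j , j→i , i→a)) =
    inj₂ ( μ-reverse sk _≟V_ a→j (inj₂ refl)
         , μ-reverse sk _≟V_ j→i (inj₁ refl)
         , out-neighbours a→j i j→i (arrow-reverse sk i→a))
  preserves-frozen-cycles {B} sk {j} {a} out-neighbours in-neighbours i (inj₂ (j→a , i→j , a→i)) =
    inj₁ ( μ-reverse sk _≟V_ j→a (inj₁ refl)
         , μ-reverse sk _≟V_ i→j (inj₂ refl)
         , arrow-reverse⁻¹ (μ-skew _≟V_ sk (inj₁ j)) {inj₁ i} {inj₂ a}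
                           (in-neighbours (arrow-reverse sk j→a) i i→j a→i))

  mutPart-skew : ∀ {B : Mat (Vtx f)} → Skew B → Skew (mutPart B)
  mutPart-skew sk x y = sk (inj₁ x) (inj₁ y)

  data Settled (B : Mat (Vtx f)) (l : Fin 3) (a : Fin f) : Set where
    sparse     : Sparse (row B a) → Settled B l a
    cyclic     : ∀ {p q} → Cyclic (mutPart B) l p q
               → CycleCompatible (row B a l) (row B a p) (row B a q) → Settled B l a
    transitive : ∀ {s t} → Transitive (mutPart B) s t l
               → SinkCompatible (row B a s) (row B a t) (row B a l) → Settled B l a

  Settles : Mat (Vtx f) → Fin 3 → Fin f → Set
  Settles B j a = Settled (μ₁ B j) j a × PreservesFrozenCycles B j a

  row-unchanged : ∀ (B : Mat (Vtx f)) a {j} → row B a j ≡ 0ℤ → ∀ v → row (μ₁ B j) a v ≡ row B a v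
  row-unchanged B a {j} cj≡0 v = unchanged (v FinP.≟ j)
    where
    unchanged : Dec (v ≡ j) → row (μ₁ B j) a v ≡ row B a v
    unchanged (yes refl) = trans (row-pivot B a j) (trans (cong -_ cj≡0) (sym cj≡0))
    unchanged (no v≢j) = trans (row-away B a v≢j)
                           (trans (cong (λ p → mutate (row B a v) p (mutPart B j v)) cj≡0)
                                  (mutate-0 (row B a v) (mutPart B j v)))

  zero-preserves : ∀ {B : Mat (Vtx f)} → Skew B → ∀ {j a} → row B a j ≡ 0ℤ → PreservesFrozenCycles B j a
  zero-preserves sk {j} {a} cj≡0 =
    preserves-frozen-cycles sk {j} {a} (λ 0<cj → ⊥-elim (ℤP.<-irrefl (sym cj≡0) 0<cj))
                               (λ cj<0 → ⊥-elim (ℤP.<-irrefl cj≡0 cj<0))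

  module CycleStep {B : Mat (Vtx f)} (sk : Skew B) (a : Fin f) {j o i : Fin 3}
                 (j→o : 0ℤ < mutPart B j o) (i→j : 0ℤ < mutPart B i j)
                 (cycle′ : Cyclic (mutPart (μ₁ B j)) j i o) where

    private
      M = mutPart B
      c = row B a
      c′ = row (μ₁ B j) a
      skM : Skew M
      skM = mutPart-skew sk
      j≢o : j ≢ o
      j≢o = arrow⇒≢ skM j→o
      i≢j : i ≢ j
      i≢j = arrow⇒≢ skM i→j
      i≢o : i ≢ o
      i≢o = arrow⇒≢ (mutPart-skew (μ-skew _≟V_ sk (inj₁ j))) (proj₁ (proj₂ cycle′))
      cover : ∀ v → v ≡ j ⊎ v ≡ o ⊎ v ≡ i
      cover = Fin3-cover j≢o (i≢o ∘ sym) (i≢j ∘ sym)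

      out-neighbour : ∀ {v} → 0ℤ < M j v → v ≡ o
      out-neighbour {v} j→v with cover v
      ... | inj₁ refl = ⊥-elim (arrow⇒≢ skM j→v refl)
      ... | inj₂ (inj₁ v≡o) = v≡o
      ... | inj₂ (inj₂ refl) = ⊥-elim (ℤP.<-asym j→v (arrow-reverse skM i→j))

      in-neighbour : ∀ {v} → 0ℤ < M v j → v ≡ i
      in-neighbour {v} v→j with cover v
      ... | inj₁ refl = ⊥-elim (arrow⇒≢ skM v→j refl)
      ... | inj₂ (inj₁ refl) = ⊥-elim (ℤP.<-asym v→j (arrow-reverse skM j→o))
      ... | inj₂ (inj₂ v≡i) = v≡i

      c′-o : 0ℤ ≤ c j → c′ o ≡ c o + c j * M j o
      c′-o 0≤cj = trans (row-away B a (j≢o ∘ sym)) (mutate-≥0-≥0 (c o) 0≤cj (ℤP.<⇒≤ j→o))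

      c′-o-fixed : c j ≤ 0ℤ → c′ o ≡ c o
      c′-o-fixed cj≤0 = trans (row-away B a (j≢o ∘ sym)) (mutate-≤0-≥0 (c o) cj≤0 (ℤP.<⇒≤ j→o))

      c′-i : c j ≤ 0ℤ → c′ i ≡ c i + c j * M i j
      c′-i cj≤0 = begin
        c′ i                      ≡⟨ row-away B a i≢j ⟩
        mutate (c i) (c j) (M j i) ≡⟨ mutate-≤0-≤0 (c i) cj≤0 (ℤP.<⇒≤ (arrow-reverse skM i→j)) ⟩
        c i - c j * M j i         ≡⟨ cong (λ z → c i - c j * z) (skM i j) ⟩
        c i - c j * - M i j       ≡⟨ simplify (c i) (c j) (M i j) ⟩
        c i + c j * M i j         ∎
        where
        open ≡-Reasoning
        simplify : ∀ x y z → x - y * - z ≡ x + y * z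
        simplify = solve-∀

      c′-i-fixed : 0ℤ ≤ c j → c′ i ≡ c i
      c′-i-fixed 0≤cj =
        trans (row-away B a i≢j) (mutate-≥0-≤0 (c i) 0≤cj (ℤP.<⇒≤ (arrow-reverse skM i→j)))

    settles⁺ : 0ℤ < c j → c j ≤ c o + c j * M j o → Settles B j a
    settles⁺ 0<cj cj≤c′o =
        cyclic cycle′ (negative c′j<0 0<c′o -c′j≤c′o)
      , preserves-frozen-cycles sk
          (λ _ v j→v _ → subst (λ w → 0ℤ < c′ w) (sym (out-neighbour j→v)) 0<c′o)
          (λ cj<0 → ⊥-elim (ℤP.<-asym 0<cj cj<0))
      where
      c′o≡ = c′-o (ℤP.<⇒≤ 0<cj)
      c′j<0 : c′ j < 0ℤ
      c′j<0 = subst (_< 0ℤ) (sym (row-pivot B a j)) (ℤP.neg-mono-< 0<cj)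
      0<c′o : 0ℤ < c′ o
      0<c′o = subst (0ℤ <_) (sym c′o≡) (ℤP.<-≤-trans 0<cj cj≤c′o)
      -c′j≤c′o : - c′ j ≤ c′ o
      -c′j≤c′o = subst₂ _≤_ (trans (sym (ℤP.neg-involutive (c j))) (cong -_ (sym (row-pivot B a j))))
                            (sym c′o≡) cj≤c′o

    settles⁻ : c j < 0ℤ → c i + c j * M i j ≤ c j → Settles B j a
    settles⁻ cj<0 c′i≤cj =
        cyclic cycle′ (positive 0<c′j c′i<0 c′j≤-c′i)
      , preserves-frozen-cycles sk
          (λ 0<cj → ⊥-elim (ℤP.<-asym 0<cj cj<0))
          (λ _ v v→j _ → subst (λ w → c′ w < 0ℤ) (sym (in-neighbour v→j)) c′i<0)
      where
      c′i≡ = c′-i (ℤP.<⇒≤ cj<0)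
      0<c′j : 0ℤ < c′ j
      0<c′j = subst (0ℤ <_) (sym (row-pivot B a j)) (ℤP.neg-mono-< cj<0)
      c′i<0 : c′ i < 0ℤ
      c′i<0 = subst (_< 0ℤ) (sym c′i≡) (ℤP.≤-<-trans c′i≤cj cj<0)
      c′j≤-c′i : c′ j ≤ - c′ i
      c′j≤-c′i = subst₂ _≤_ (sym (row-pivot B a j)) (cong -_ (sym c′i≡)) (ℤP.neg-mono-≤ c′i≤cj)

    settles⁰ : c j ≡ 0ℤ → c i < 0ℤ → 0ℤ < c o → Settles B j a
    settles⁰ cj≡0 ci<0 0<co =
        cyclic cycle′ (vanishing (trans (row-pivot B a j) (cong -_ cj≡0))
                                 (subst (_< 0ℤ) (sym (c′-i-fixed (ℤP.≤-reflexive (sym cj≡0)))) ci<0)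
                                 (subst (0ℤ <_) (sym (c′-o-fixed (ℤP.≤-reflexive cj≡0))) 0<co))
      , zero-preserves sk cj≡0

    shrinks⁺ : + 2 ≤ M j o → 0ℤ < c j → c o + c j * M j o < c j → norm₁ c′ ℕ.< norm₁ c
    shrinks⁺ 2≤Mjo 0<cj c′o<cj = norm₁-< {c} {c′} bounded o strict
      where
      strict : ∣ c′ o ∣ ℕ.< ∣ c o ∣
      strict = subst (λ z → ∣ z ∣ ℕ.< ∣ c o ∣) (sym (c′-o (ℤP.<⇒≤ 0<cj)))
                     (∣y+x*k∣<∣y∣ {c j} {c o} {M j o} 0<cj 2≤Mjo c′o<cj)
      bounded : ∀ v → ∣ c′ v ∣ ℕ.≤ ∣ c v ∣
      bounded v with cover v
      ... | inj₁ refl = ℕP.≤-reflexive (trans (cong ∣_∣ (row-pivot B a j)) (ℤP.∣-i∣≡∣i∣ (c j)))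
      ... | inj₂ (inj₁ refl) = ℕP.<⇒≤ strict
      ... | inj₂ (inj₂ refl) = ℕP.≤-reflexive (cong ∣_∣ (c′-i-fixed (ℤP.<⇒≤ 0<cj)))

    shrinks⁻ : + 2 ≤ M i j → c j < 0ℤ → c j < c i + c j * M i j → norm₁ c′ ℕ.< norm₁ c
    shrinks⁻ 2≤Mij cj<0 cj<c′i = norm₁-< {c} {c′} bounded i strict
      where
      strict : ∣ c′ i ∣ ℕ.< ∣ c i ∣
      strict = subst (λ z → ∣ z ∣ ℕ.< ∣ c i ∣) (sym (c′-i (ℤP.<⇒≤ cj<0)))
                     (∣y+x*k∣<∣y∣′ {c j} {c i} {M i j} cj<0 2≤Mij cj<c′i)
      bounded : ∀ v → ∣ c′ v ∣ ℕ.≤ ∣ c v ∣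
      bounded v with cover v
      ... | inj₁ refl = ℕP.≤-reflexive (trans (cong ∣_∣ (row-pivot B a j)) (ℤP.∣-i∣≡∣i∣ (c j)))
      ... | inj₂ (inj₁ refl) = ℕP.≤-reflexive (cong ∣_∣ (c′-o-fixed (ℤP.<⇒≤ cj<0)))
      ... | inj₂ (inj₂ refl) = ℕP.<⇒≤ strict

  module SourceStep {B : Mat (Vtx f)} (sk : Skew B) (a : Fin f) {s m t : Fin 3}
                (chain : Transitive (mutPart B) s m t) where

    private
      M = mutPart B
      c = row B a
      c′ = row (μ₁ B s) a
      ν ν′ : Fin 3 → ℕ
      ν v = negPart (c v)
      ν′ v = negPart (c′ v)
      skM : Skew M
      skM = mutPart-skew sk
      s→m = proj₁ chain
      s→t = proj₂ (proj₂ chain)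
      cover : ∀ v → v ≡ s ⊎ v ≡ m ⊎ v ≡ t
      cover = Transitive-cover skM chain
      m≢s : m ≢ s
      m≢s = arrow⇒≢ skM s→m ∘ sym
      t≢s : t ≢ s
      t≢s = arrow⇒≢ skM s→t ∘ sym

      out-neighbour : ∀ {v} → v ≢ s → 0ℤ < M s v
      out-neighbour {v} v≢s with cover v
      ... | inj₁ v≡s = contradiction v≡s v≢s
      ... | inj₂ (inj₁ refl) = s→m
      ... | inj₂ (inj₂ refl) = s→t

      no-in-neighbour : ∀ {v} → 0ℤ < M v s → ⊥
      no-in-neighbour {v} v→s with v FinP.≟ s
      ... | yes refl = arrow⇒≢ skM v→s refl
      ... | no v≢s = ℤP.<-asym v→s (arrow-reverse skM (out-neighbour v≢s))

      c′-out : 0ℤ ≤ c s → ∀ {v} → v ≢ s → c′ v ≡ c v + c s * M s v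
      c′-out 0≤cs {v} v≢s =
        trans (row-away B a v≢s) (mutate-≥0-≥0 (c v) 0≤cs (ℤP.<⇒≤ (out-neighbour v≢s)))

      negPart-c′s : 0ℤ ≤ c s → ν′ s ≡ ∣ c s ∣
      negPart-c′s 0≤cs = trans (cong negPart (row-pivot B a s)) (negPart[-i]≡∣i∣ 0≤cs)

      negPart-out : 0ℤ ≤ c s → ∀ {v} → v ≢ s → ν′ v ℕ.≤ ν v
      negPart-out 0≤cs {v} v≢s = subst (λ z → negPart z ℕ.≤ ν v) (sym (c′-out 0≤cs v≢s))
                                       (negPart-antimono (ℤP.i≤i+j (c v) (c s * M s v) ⦃ nonneg ⦄))
        where
        nonneg = ℤ.nonNegative (0≤i*j 0≤cs (ℤP.<⇒≤ (out-neighbour v≢s)))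

    c′-fixed : c s ≤ 0ℤ → ∀ {v} → v ≢ s → c′ v ≡ c v
    c′-fixed cs≤0 {v} v≢s =
      trans (row-away B a v≢s) (mutate-≤0-≥0 (c v) cs≤0 (ℤP.<⇒≤ (out-neighbour v≢s)))

    settles : 0ℤ < c s → c s ≤ c m + c s * M s m → c s ≤ c t + c s * M s t → Settles B s a
    settles 0<cs cs≤c′m cs≤c′t =
        transitive {s = m} {t = t} (Transitive-μ-source sk _≟V_ chain)
                   ( 0<c′ m≢s cs≤c′m , 0<c′ t≢s cs≤c′t , c′s≤0
                   , bound m≢s cs≤c′m , bound t≢s cs≤c′t)
      , preserves-frozen-cycles sk
          (λ _ v s→v _ → positive-after (arrow⇒≢ skM s→v ∘ sym))
          (λ cs<0 → ⊥-elim (ℤP.<-asym 0<cs cs<0))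
      where
      0<c′ : ∀ {v} (v≢s : v ≢ s) → c s ≤ c v + c s * M s v → 0ℤ < c′ v
      0<c′ v≢s cs≤ = subst (0ℤ <_) (sym (c′-out (ℤP.<⇒≤ 0<cs) v≢s)) (ℤP.<-≤-trans 0<cs cs≤)
      bound : ∀ {v} (v≢s : v ≢ s) → c s ≤ c v + c s * M s v → - c′ s ≤ c′ v
      bound v≢s cs≤ = subst₂ _≤_ (trans (sym (ℤP.neg-involutive (c s))) (cong -_ (sym (row-pivot B a s))))
                               (sym (c′-out (ℤP.<⇒≤ 0<cs) v≢s)) cs≤
      c′s≤0 : c′ s ≤ 0ℤ
      c′s≤0 = subst (_≤ 0ℤ) (sym (row-pivot B a s)) (ℤP.neg-mono-≤ (ℤP.<⇒≤ 0<cs))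
      positive-after : ∀ {v} → v ≢ s → 0ℤ < c′ v
      positive-after {v} v≢s with cover v
      ... | inj₁ v≡s = contradiction v≡s v≢s
      ... | inj₂ (inj₁ refl) = 0<c′ m≢s cs≤c′m
      ... | inj₂ (inj₂ refl) = 0<c′ t≢s cs≤c′t

    flip-preserves : c s < 0ℤ → PreservesFrozenCycles B s a
    flip-preserves cs<0 =
      preserves-frozen-cycles sk (λ 0<cs → ⊥-elim (ℤP.<-asym 0<cs cs<0))
                                 (λ _ v v→s _ → ⊥-elim (no-in-neighbour v→s))

    shrinks-m : + 2 ≤ M s m → 0ℤ < c s → c m + c s * M s m < c s → negMass c′ m t s ℕ.< negMass c s m t
    shrinks-m 2≤Msm 0<cs c′m<cs = begin-strict
      ν′ m ℕ.+ ν′ t ℕ.+ ν′ s      ≡⟨ cong (ν′ m ℕ.+ ν′ t ℕ.+_) (negPart-c′s 0≤cs) ⟩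
      ν′ m ℕ.+ ν′ t ℕ.+ ∣ c s ∣   ≡⟨ xy∙z≈xz∙y (ν′ m) (ν′ t) ∣ c s ∣ ⟩
      ν′ m ℕ.+ ∣ c s ∣ ℕ.+ ν′ t   <⟨ ℕP.+-mono-<-≤ overshoot (negPart-out 0≤cs t≢s) ⟩
      ν m ℕ.+ ν t                 ≡⟨ cong (λ z → z ℕ.+ ν m ℕ.+ ν t) (negPart-≥0 0≤cs) ⟨
      ν s ℕ.+ ν m ℕ.+ ν t         ∎
      where
      open ℕP.≤-Reasoning
      0≤cs = ℤP.<⇒≤ 0<cs
      overshoot : ν′ m ℕ.+ ∣ c s ∣ ℕ.< ν m
      overshoot = subst (λ z → negPart z ℕ.+ ∣ c s ∣ ℕ.< ν m) (sym (c′-out 0≤cs m≢s))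
                        (negPart[y+x*k]+∣x∣<negPart[y] {c s} {c m} {M s m} 0<cs 2≤Msm c′m<cs)

    shrinks-t : + 2 ≤ M s t → 0ℤ < c s → c t + c s * M s t < c s → negMass c′ m t s ℕ.< negMass c s m t
    shrinks-t 2≤Mst 0<cs c′t<cs = begin-strict
      ν′ m ℕ.+ ν′ t ℕ.+ ν′ s       ≡⟨ cong (ν′ m ℕ.+ ν′ t ℕ.+_) (negPart-c′s 0≤cs) ⟩
      ν′ m ℕ.+ ν′ t ℕ.+ ∣ c s ∣    ≡⟨ ℕP.+-assoc (ν′ m) (ν′ t) ∣ c s ∣ ⟩
      ν′ m ℕ.+ (ν′ t ℕ.+ ∣ c s ∣)  <⟨ ℕP.+-mono-≤-< (negPart-out 0≤cs m≢s) overshoot ⟩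
      ν m ℕ.+ ν t                  ≡⟨ cong (λ z → z ℕ.+ ν m ℕ.+ ν t) (negPart-≥0 0≤cs) ⟨
      ν s ℕ.+ ν m ℕ.+ ν t          ∎
      where
      open ℕP.≤-Reasoning
      0≤cs = ℤP.<⇒≤ 0<cs
      overshoot : ν′ t ℕ.+ ∣ c s ∣ ℕ.< ν t
      overshoot = subst (λ z → negPart z ℕ.+ ∣ c s ∣ ℕ.< ν t) (sym (c′-out 0≤cs t≢s))
                        (negPart[y+x*k]+∣x∣<negPart[y] {c s} {c t} {M s t} 0<cs 2≤Mst c′t<cs)

    shrinks-flip : c s < 0ℤ → negMass c′ m t s ℕ.< negMass c s m t
    shrinks-flip cs<0 = begin-strict
      ν′ m ℕ.+ ν′ t ℕ.+ ν′ s     ≡⟨ cong₂ (λ x y → x ℕ.+ y ℕ.+ ν′ s) (same m≢s) (same t≢s) ⟩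
      ν m ℕ.+ ν t ℕ.+ ν′ s       ≡⟨ cong (ν m ℕ.+ ν t ℕ.+_) c′s-nonneg ⟩
      ν m ℕ.+ ν t ℕ.+ 0          ≡⟨ ℕP.+-identityʳ _ ⟩
      ν m ℕ.+ ν t                <⟨ ℕP.m<n+m _ (0<negPart cs<0) ⟩
      ν s ℕ.+ (ν m ℕ.+ ν t)      ≡⟨ ℕP.+-assoc (ν s) (ν m) (ν t) ⟨
      ν s ℕ.+ ν m ℕ.+ ν t        ∎
      where
      open ℕP.≤-Reasoning
      cs≤0 = ℤP.<⇒≤ cs<0
      same : ∀ {v} → v ≢ s → ν′ v ≡ ν v
      same v≢s = cong negPart (c′-fixed cs≤0 v≢s)
      c′s-nonneg : ν′ s ≡ 0
      c′s-nonneg = trans (cong negPart (row-pivot B a s)) (negPart-≥0 (ℤP.neg-mono-≤ cs≤0))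

  KeepsCycles : Mat (Vtx f) → Fin 3 → Set
  KeepsCycles B j = ∀ {o i} → Cyclic (mutPart B) j o i → Cyclic (mutPart (μ₁ B j)) j i o

  data Phase (B : Mat (Vtx f)) (l : Fin 3) : Set where
    cyclic : ∀ {x y z} → Cyclic (mutPart B) x y z → Phase B l
    sink   : ∀ {s t} → Transitive (mutPart B) s t l → Phase B l

  module _ {B : Mat (Vtx f)} (sk : Skew B) (heavy : Heavy (mutPart B)) (a : Fin f) where

    cycle-step : ∀ {j o i} (j→o : 0ℤ < mutPart B j o) (i→j : 0ℤ < mutPart B i j)
                 → Cyclic (mutPart (μ₁ B j)) j i o → CycleReady (row B a) j o i → Settles B j a
    cycle-step j→o i→j cycle′ (ready⁺ 0<cj -cj≤co) =
      CycleStep.settles⁺ sk a j→o i→j cycle′ 0<cj (x≤y+x*k 0<cj -cj≤co (heavy _ _ j→o))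
    cycle-step j→o i→j cycle′ (ready⁻ cj<0 ci≤-cj) =
      CycleStep.settles⁻ sk a j→o i→j cycle′ cj<0 (y+x*k≤x cj<0 ci≤-cj (heavy _ _ i→j))
    cycle-step j→o i→j cycle′ (ready⁰ cj≡0 ci<0 0<co) =
      CycleStep.settles⁰ sk a j→o i→j cycle′ cj≡0 ci<0 0<co

    middle-step : ∀ {s j t} → Transitive (mutPart B) s j t → CycleReady (row B a) j t s → Settles B j a
    middle-step chain = cycle-step (proj₁ (proj₂ chain)) (proj₁ chain) (Transitive⇒Cyclic-μ-middle sk _≟V_ chain)

    source-step : ∀ {s m t} → Transitive (mutPart B) s m t → 0ℤ < row B a s
                → - row B a s ≤ row B a m → - row B a s ≤ row B a t → Settles B s a
    source-step chain 0<cs -cs≤cm -cs≤ct =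
      SourceStep.settles sk a chain 0<cs (x≤y+x*k 0<cs -cs≤cm (heavy _ _ (proj₁ chain)))
                                     (x≤y+x*k 0<cs -cs≤ct (heavy _ _ (proj₂ (proj₂ chain))))

    private
      skM : Skew (mutPart B)
      skM = mutPart-skew sk

    sparse-step : ∀ {l j} → KeepsCycles B j → Phase B l → j ≢ l
                → Sparse (row B a) → row B a j ≢ 0ℤ → Settles B j a
    sparse-step {j = j} keeps (cyclic cyc) _ sp cj≢0 with Cyclic-through skM cyc j
    ... | o , i , cyc-j =
      cycle-step (proj₁ cyc-j) (proj₂ (proj₂ cyc-j)) (keeps cyc-j)
                   (ready-sparse cj≢0 (Sparse-rest sp cj≢0 o (arrow⇒≢ skM (proj₁ cyc-j) ∘ sym))
                                      (Sparse-rest sp cj≢0 i (arrow⇒≢ skM (proj₂ (proj₂ cyc-j)))))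
    sparse-step {j = j} keeps (sink {s} {t} chain) j≢l sp cj≢0 with Transitive-cover skM chain j
    ... | inj₂ (inj₂ j≡l) = contradiction j≡l j≢l
    ... | inj₂ (inj₁ refl) =
      middle-step chain (ready-sparse cj≢0 (Sparse-rest sp cj≢0 _ (j≢l ∘ sym))
                                          (Sparse-rest sp cj≢0 s (arrow⇒≢ skM (proj₁ chain))))
    ... | inj₁ refl with ℤP.<-cmp 0ℤ (row B a j)
    ...   | tri≈ _ 0≡cj _ = contradiction (sym 0≡cj) cj≢0
    ...   | tri< 0<cj _ _ =
      source-step chain 0<cj (above (Sparse-rest sp cj≢0 t (arrow⇒≢ skM (proj₁ chain) ∘ sym)))
                             (above (Sparse-rest sp cj≢0 _ (j≢l ∘ sym)))
      where
      above : ∀ {v} → row B a v ≡ 0ℤ → - row B a j ≤ row B a v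
      above cv≡0 = i>0∧j≥0⇒-i≤j 0<cj (ℤP.≤-reflexive (sym cv≡0))
    ...   | tri> _ _ cj<0 =
        sparse (Sparse-transfer sp λ v cv≡0 →
                  trans (SourceStep.c′-fixed sk a chain (ℤP.<⇒≤ cj<0) (v≢j cv≡0)) cv≡0)
      , SourceStep.flip-preserves sk a chain cj<0
      where
      v≢j : ∀ {v} → row B a v ≡ 0ℤ → v ≢ j
      v≢j cv≡0 refl = cj≢0 cv≡0

    settled-step : ∀ {l j} → KeepsCycles B j → Phase B l → j ≢ l → Settled B l a → Settles B j a
    settled-step {j = j} keeps phase j≢l (sparse sp) with row B a j ℤ.≟ 0ℤ
    ... | yes cj≡0 =
        sparse (Sparse-transfer sp (λ v cv≡0 → trans (row-unchanged B a cj≡0 v) cv≡0))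
      , zero-preserves sk cj≡0
    ... | no cj≢0 = sparse-step keeps phase j≢l sp cj≢0
    settled-step {j = j} keeps _ j≢l (cyclic cyc compat) with Cyclic-cover skM cyc j
    ... | inj₁ j≡l = contradiction j≡l j≢l
    ... | inj₂ (inj₁ refl) =
      cycle-step (proj₁ (proj₂ cyc)) (proj₁ cyc) (keeps (Cyclic-rotate {b = mutPart B} cyc))
                   (ready-after-first compat)
    ... | inj₂ (inj₂ refl) =
      cycle-step (proj₂ (proj₂ cyc)) (proj₁ (proj₂ cyc))
                   (keeps (Cyclic-rotate {b = mutPart B} (Cyclic-rotate {b = mutPart B} cyc)))
                   (ready-before-first compat)
    settled-step {j = j} _ _ j≢l (transitive chain (0<cs , 0<ct , _ , -cl≤cs , -cl≤ct))
      with Transitive-cover skM chain j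
    ... | inj₁ refl =
      source-step chain 0<cs (i>0∧j≥0⇒-i≤j 0<cs (ℤP.<⇒≤ 0<ct)) (-i≤j⇒-j≤i -cl≤cs)
    ... | inj₂ (inj₁ refl) = middle-step chain (ready⁺ 0<ct (-i≤j⇒-j≤i -cl≤ct))
    ... | inj₂ (inj₂ j≡l) = contradiction j≡l j≢l

    cycle-progress : ∀ {j o i} (j→o : 0ℤ < mutPart B j o) (i→j : 0ℤ < mutPart B i j)
                   → Cyclic (mutPart (μ₁ B j)) j i o
                   → Settled (μ₁ B j) j a
                   ⊎ norm₁ (row (μ₁ B j) a) ℕ.< norm₁ (row B a)
                   ⊎ row B a j ≡ 0ℤ
    cycle-progress {j} {o} {i} j→o i→j cycle′ with ℤP.<-cmp 0ℤ (row B a j)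
    ... | tri≈ _ 0≡cj _ = inj₂ (inj₂ (sym 0≡cj))
    ... | tri< 0<cj _ _ with row B a j ℤP.≤? row B a o + row B a j * mutPart B j o
    ...   | yes reaches = inj₁ (proj₁ (CycleStep.settles⁺ sk a j→o i→j cycle′ 0<cj reaches))
    ...   | no short =
      inj₂ (inj₁ (CycleStep.shrinks⁺ sk a j→o i→j cycle′ (heavy _ _ j→o) 0<cj (ℤP.≰⇒> short)))
    cycle-progress {j} {o} {i} j→o i→j cycle′ | tri> _ _ cj<0
      with row B a i + row B a j * mutPart B i j ℤP.≤? row B a j
    ...   | yes reaches = inj₁ (proj₁ (CycleStep.settles⁻ sk a j→o i→j cycle′ cj<0 reaches))
    ...   | no short =
      inj₂ (inj₁ (CycleStep.shrinks⁻ sk a j→o i→j cycle′ (heavy _ _ i→j) cj<0 (ℤP.≰⇒> short)))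

    source-progress : ∀ {s m t} → Transitive (mutPart B) s m t
                    → Settled (μ₁ B s) s a
                    ⊎ negMass (row (μ₁ B s) a) m t s ℕ.< negMass (row B a) s m t
                    ⊎ row B a s ≡ 0ℤ
    source-progress {s} {m} {t} chain with ℤP.<-cmp 0ℤ (row B a s)
    ... | tri≈ _ 0≡cs _ = inj₂ (inj₂ (sym 0≡cs))
    ... | tri> _ _ cs<0 = inj₂ (inj₁ (SourceStep.shrinks-flip sk a chain cs<0))
    ... | tri< 0<cs _ _ with row B a s ℤP.≤? row B a m + row B a s * mutPart B s m
                           | row B a s ℤP.≤? row B a t + row B a s * mutPart B s t
    ...   | yes reaches-m | yes reaches-t =
      inj₁ (proj₁ (SourceStep.settles sk a chain 0<cs reaches-m reaches-t))
    ...   | no short | _ =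
      inj₂ (inj₁ (SourceStep.shrinks-m sk a chain (heavy _ _ (proj₁ chain)) 0<cs (ℤP.≰⇒> short)))
    ...   | yes _ | no short =
      inj₂ (inj₁ (SourceStep.shrinks-t sk a chain (heavy _ _ (proj₂ (proj₂ chain))) 0<cs (ℤP.≰⇒> short)))

  PhaseBefore : Mat (Vtx f) → Fin 3 → Set
  PhaseBefore B j = (Σ (Fin 3) λ x → Σ (Fin 3) λ y → Σ (Fin 3) λ z → Cyclic (mutPart B) x y z)
              ⊎ (Σ (Fin 3) λ s → Σ (Fin 3) λ m → Σ (Fin 3) λ t → Transitive (mutPart B) s m t × j ≢ t)

  Phase⇒PhaseBefore : ∀ {B l j} → Phase B l → j ≢ l → PhaseBefore B j
  Phase⇒PhaseBefore (cyclic cyc) _ = inj₁ (_ , _ , _ , cyc)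
  Phase⇒PhaseBefore (sink chain) j≢l = inj₂ (_ , _ , _ , chain , j≢l)

  advance : ∀ {B j} → Skew B → KeepsCycles B j → PhaseBefore B j → Phase (μ₁ B j) j
  advance {B} {j} sk keeps (inj₁ (_ , _ , _ , cyc)) with Cyclic-through (mutPart-skew sk) cyc j
  ... | o , i , cyc-j = cyclic {x = j} {y = i} {z = o} (keeps cyc-j)
  advance {B} {j} sk keeps (inj₂ (s , m , t , chain , j≢t)) with Transitive-cover (mutPart-skew sk) chain j
  ... | inj₁ refl = sink {s = m} {t = t} (Transitive-μ-source sk _≟V_ chain)
  ... | inj₂ (inj₁ refl) = cyclic {x = j} {y = s} {z = t} (Transitive⇒Cyclic-μ-middle sk _≟V_ chain)
  ... | inj₂ (inj₂ j≡t) = contradiction j≡t j≢t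

  cycle-preserving-at : ∀ {B : Mat (Vtx f)} {j}
    → (∀ u w → OrientedCycle noFrozen (mutPart B) u j w → OrientedCycle noFrozen (mutPart (μ₁ B j)) u j w)
    → (∀ a → PreservesFrozenCycles B j a)
    → CyclePreservingAt _≟V_ frozenV B (inj₁ j)
  cycle-preserving-at mutable frozen (inj₁ u) (inj₁ w) (u≢j , j≢w , u≢w , _ , cyc) =
    u≢j , j≢w , u≢w , ℕ.z≤n , proj₂ (proj₂ (proj₂ (proj₂
      (mutable u w ((u≢j ∘ cong inj₁) , (j≢w ∘ cong inj₁) , (u≢w ∘ cong inj₁) , ℕ.z≤n , cyc)))))
  cycle-preserving-at mutable frozen (inj₂ a) (inj₁ w) (a≢j , j≢w , a≢w , one , cyc) =
    a≢j , j≢w , a≢w , one , frozen a w cyc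
  cycle-preserving-at {B} {j} mutable frozen (inj₁ u) (inj₂ a) (u≢j , j≢a , u≢a , one , cyc) =
    u≢j , j≢a , u≢a , one ,
    NotAcyclic-swap {b = μ₁ B j} {inj₂ a} {inj₁ j} {inj₁ u} (frozen a u (NotAcyclic-swap {b = B} cyc))
  cycle-preserving-at _ _ (inj₂ _) (inj₂ _) (_ , _ , _ , ℕ.s≤s () , _)

-- Eventual settling

descend : ∀ {S R : Set} (weight : S → ℕ) → (∀ s → R ⊎ Σ S λ s′ → weight s′ ℕ.< weight s) → S → R
descend {S} {R} weight step s = go (wellFounded weight <-wellFounded s)
  where
  go : ∀ {s} → Acc (ℕ._<_ on weight) s → R
  go {s} (acc smaller) with step s
  ... | inj₁ r = r
  ... | inj₂ (s′ , lighter) = go (smaller lighter)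

Eventually : (ℕ → Set) → Set
Eventually P = ∃[ s ] ∀ n → s ℕ.≤ n → P n

invariant⇒eventually : ∀ {P : ℕ → Set} → (∀ n → P n → P (suc n)) → ∀ {s} → P s → Eventually P
invariant⇒eventually {P} step {s} Ps = s , λ n s≤n → from (ℕP.≤⇒≤′ s≤n)
  where
  from : ∀ {n} → s ≤′ n → P n
  from ℕ.≤′-refl = Ps
  from (ℕ.≤′-step s≤′n) = step _ (from s≤′n)

Eventually-∀ : ∀ {k} {P : Fin k → ℕ → Set}
             → (∀ i → Eventually (P i)) → Eventually (λ n → ∀ i → P i n)
Eventually-∀ {zero} _ = 0 , λ _ _ ()
Eventually-∀ {suc k} ev with ev zero | Eventually-∀ (ev ∘ suc)
... | s₀ , P₀ | s₁ , P₁ = s₀ ℕ.⊔ s₁ , λ where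
  n s≤n zero → P₀ n (ℕP.≤-trans (ℕP.m≤m⊔n s₀ s₁) s≤n)
  n s≤n (suc i) → P₁ n (ℕP.≤-trans (ℕP.m≤n⊔m s₀ s₁) s≤n) i

zeroFlag : ℤ → ℕ
zeroFlag (+ zero) = 1
zeroFlag (+ suc _) = 0
zeroFlag -[1+ _ ] = 0

zeroFlag≤1 : ∀ i → zeroFlag i ℕ.≤ 1
zeroFlag≤1 (+ zero) = ℕP.≤-refl
zeroFlag≤1 (+ suc _) = ℕ.z≤n
zeroFlag≤1 -[1+ _ ] = ℕ.z≤n

zeroFlag-≢0 : ∀ {i} → i ≢ 0ℤ → zeroFlag i ≡ 0
zeroFlag-≢0 {+ zero} i≢0 = contradiction refl i≢0
zeroFlag-≢0 {+ suc _} _ = refl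
zeroFlag-≢0 { -[1+ _ ]} _ = refl

2*a′+d′<2*a+d : ∀ {a a′} d {d′} → a′ ℕ.< a → d′ ℕ.≤ 1
              → 2 ℕ.* a′ ℕ.+ d′ ℕ.< 2 ℕ.* a ℕ.+ d
2*a′+d′<2*a+d {a} {a′} d {d′} a′<a d′≤1 = begin-strict
  2 ℕ.* a′ ℕ.+ d′    ≤⟨ ℕP.+-monoʳ-≤ (2 ℕ.* a′) d′≤1 ⟩
  2 ℕ.* a′ ℕ.+ 1     <⟨ ℕP.+-monoʳ-< (2 ℕ.* a′) (ℕP.n<1+n 1) ⟩
  2 ℕ.* a′ ℕ.+ 2     ≡⟨ ℕP.+-comm (2 ℕ.* a′) 2 ⟩
  2 ℕ.+ 2 ℕ.* a′     ≡⟨ ℕP.*-suc 2 a′ ⟨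
  2 ℕ.* suc a′       ≤⟨ ℕP.*-monoʳ-≤ 2 a′<a ⟩
  2 ℕ.* a            ≤⟨ ℕP.m≤m+n (2 ℕ.* a) d ⟩
  2 ℕ.* a ℕ.+ d      ∎
  where open ℕP.≤-Reasoning

flag-drop : ∀ {a a′ d d′} → a′ ≡ a → d′ ≡ 0 → d ≡ 1 → 2 ℕ.* a′ ℕ.+ d′ ℕ.< 2 ℕ.* a ℕ.+ d
flag-drop {a} refl refl refl = ℕP.+-monoʳ-< (2 ℕ.* a) (ℕP.n<1+n 0)

module Evolution {f : ℕ} (b : Mat (Vtx f)) (m : ℕ → Fin 3) (sk : Skew b)
                 (heavy : ∀ n → Heavy (mutPart (Qseq b m n)))
                 (keeps : ∀ n → KeepsCycles (Qseq b m n) (m n))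
                 (reduced : Reduced m) (start : PhaseBefore b (m 0)) where

  private
    Q : ℕ → Mat (Vtx f)
    Q = Qseq b m
    skewQ : ∀ n → Skew (Q n)
    skewQ = iter-skew _≟V_ sk (λ n → inj₁ (m n))
    m≢m-next : ∀ n → m (suc n) ≢ m n
    m≢m-next n = reduced n ∘ sym

  phase : ∀ n → Phase (Q (suc n)) (m n)
  phase zero = advance sk (keeps 0) start
  phase (suc n) = advance (skewQ (suc n)) (keeps (suc n)) (Phase⇒PhaseBefore (phase n) (m≢m-next n))

  module _ (a : Fin f) where

    SettledAt : ℕ → Set
    SettledAt n = Settled (Q (suc n)) (m n) a

    settled-next : ∀ n → SettledAt n → SettledAt (suc n) × PreservesFrozenCycles (Q (suc n)) (m (suc n)) a
    settled-next n = settled-step (skewQ (suc n)) (heavy (suc n)) a (keeps (suc n)) (phase n) (m≢m-next n)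

    private
      c : ℕ → Fin 3 → ℤ
      c n = row (Q n) a

      zero-pivot : ∀ n → c n (m n) ≡ 0ℤ → SettledAt n ⊎ zeroFlag (c (suc n) (m (suc n))) ≡ 0
      zero-pivot n cm≡0 with c (suc n) (m (suc n)) ℤ.≟ 0ℤ
      ... | yes c′m≡0 =
        inj₁ (sparse (m n , m (suc n) , reduced n , trans (row-unchanged (Q n) a cm≡0 (m n)) cm≡0 , c′m≡0))
      ... | no c′m≢0 = inj₂ (zeroFlag-≢0 c′m≢0)

    CyclicState : Set
    CyclicState = Σ ℕ λ n → Σ (Fin 3) λ x → Σ (Fin 3) λ y → Σ (Fin 3) λ z → Cyclic (mutPart (Q n)) x y z

    -- A zero pivot entry keeps the mass but forces the next pivot entry to be nonzero
    -- (or the row to be sparse): doubling the mass leaves room for this tie-breaker.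
    cyclic-weight : CyclicState → ℕ
    cyclic-weight (n , _) = 2 ℕ.* norm₁ (c n) ℕ.+ zeroFlag (c n (m n))

    cyclic-settles : CyclicState → ∃ SettledAt
    cyclic-settles = descend cyclic-weight step
      where
      step : ∀ st → ∃ SettledAt ⊎ Σ CyclicState λ st′ → cyclic-weight st′ ℕ.< cyclic-weight st
      step (n , _ , _ , _ , cyc) with Cyclic-through (mutPart-skew (skewQ n)) cyc (m n)
      ... | o , i , cyc-m with cycle-progress (skewQ n) (heavy n) a (proj₁ cyc-m) (proj₂ (proj₂ cyc-m)) (keeps n cyc-m)
      ...   | inj₁ settled = inj₁ (n , settled)
      ...   | inj₂ (inj₁ shrunk) =
        inj₂ ((suc n , m n , i , o , keeps n cyc-m) , 2*a′+d′<2*a+d _ shrunk (zeroFlag≤1 _))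
      ...   | inj₂ (inj₂ cm≡0) with zero-pivot n cm≡0
      ...     | inj₁ settled = inj₁ (n , settled)
      ...     | inj₂ flag′≡0 =
        inj₂ ( (suc n , m n , i , o , keeps n cyc-m)
             , flag-drop (norm₁-cong (row-unchanged (Q n) a cm≡0)) flag′≡0 (cong zeroFlag cm≡0))

    AcyclicState : Set
    AcyclicState = Σ ℕ λ n → Σ (Fin 3) λ s → Σ (Fin 3) λ mid → Σ (Fin 3) λ t
                 → Transitive (mutPart (Q n)) s mid t × m n ≢ t

    acyclic-weight : AcyclicState → ℕ
    acyclic-weight (n , s , mid , t , _) = 2 ℕ.* negMass (c n) s mid t ℕ.+ zeroFlag (c n (m n))

    acyclic-settles : AcyclicState → ∃ SettledAt
    acyclic-settles = descend acyclic-weight step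
      where
      step : ∀ st → ∃ SettledAt ⊎ Σ AcyclicState λ st′ → acyclic-weight st′ ℕ.< acyclic-weight st
      step (n , s , mid , t , chain , m≢t) with Transitive-cover (mutPart-skew (skewQ n)) chain (m n)
      ... | inj₂ (inj₂ m≡t) = contradiction m≡t m≢t
      ... | inj₂ (inj₁ refl) =
        inj₁ (cyclic-settles (suc n , m n , s , t , Transitive⇒Cyclic-μ-middle (skewQ n) _≟V_ chain))
      ... | inj₁ refl with source-progress (skewQ n) (heavy n) a chain
      ...   | inj₁ settled = inj₁ (n , settled)
      ...   | inj₂ (inj₁ shrunk) =
        inj₂ ( (suc n , mid , t , m n , Transitive-μ-source (skewQ n) _≟V_ chain , m≢m-next n)
             , 2*a′+d′<2*a+d _ shrunk (zeroFlag≤1 _))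
      ...   | inj₂ (inj₂ cm≡0) with zero-pivot n cm≡0
      ...     | inj₁ settled = inj₁ (n , settled)
      ...     | inj₂ flag′≡0 =
        inj₂ ( (suc n , mid , t , m n , Transitive-μ-source (skewQ n) _≟V_ chain , m≢m-next n)
             , flag-drop (trans (negMass-cong (row-unchanged (Q n) a cm≡0) mid t (m n))
                                (negMass-rotate (c n) (m n) mid t))
                         flag′≡0 (cong zeroFlag cm≡0))

    eventually-settled : ∃ SettledAt
    eventually-settled = from start
      where
      from : PhaseBefore b (m 0) → ∃ SettledAt
      from (inj₁ cyc) = cyclic-settles (0 , cyc)
      from (inj₂ chain) = acyclic-settles (0 , chain)

  eventually-preserving : Eventually (λ n → ∀ a → PreservesFrozenCycles (Q n) (m n) a)
  eventually-preserving
    with Eventually-∀ (λ a → invariant⇒eventually (λ n → proj₁ ∘ settled-next a n)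
                                                   (proj₂ (eventually-settled a)))
  ... | s , settled = suc s , λ where
    (suc n) (ℕ.s≤s s≤n) a → proj₂ (settled-next a n (settled n s≤n a))

-- From the mutable part to the whole quiver

module _ {f : ℕ} (b : Mat (Vtx f)) (m : ℕ → Fin 3) (sk : Skew b) where

  private
    Q : ℕ → Mat (Vtx f)
    Q = Qseq b m
    M : Mat (Fin 3)
    M = mutPart b

  mutPart-Qseq : ∀ n → mutPart (Q n) ≐ iter FinP._≟_ M m n
  mutPart-Qseq n x y = sym (iter-restrict _≟V_ FinP._≟_ inj₁-injective b m n x y)

  mutPart-Qseq⁻¹ : ∀ n → iter FinP._≟_ M m n ≐ mutPart (Q n)
  mutPart-Qseq⁻¹ n x y = sym (mutPart-Qseq n x y)

  heavy-iterates : MutationAbundant M → ∀ n → Heavy (mutPart (Q n))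
  heavy-iterates abundant n u v 0<Muv =
    0<i∧2≤∣i∣⇒2≤i 0<Muv
      (subst (λ z → 2 ℕ.≤ ∣ z ∣) (sym as-mutList) (abundant (applyUpTo m n) u v u≢v))
    where
    as-mutList : mutPart (Q n) u v ≡ mutList FinP._≟_ M (applyUpTo m n) u v
    as-mutList = trans (mutPart-Qseq n u v) (cong (λ B → B u v) (iter≡mutList FinP._≟_ M m n))
    u≢v = arrow⇒≢ (mutPart-skew (iter-skew _≟V_ sk _ n)) 0<Muv

  keeps-cycles : CyclePreservingSeq FinP._≟_ noFrozen M m → ∀ n → KeepsCycles (Q n) (m n)
  keeps-cycles preserving n {o} {i} (j→o , o→i , i→j) = reversed (proj₂ (proj₂ (proj₂ (proj₂ after))))
    where
    skQ : Skew (mutPart (Q n))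
    skQ = mutPart-skew (iter-skew _≟V_ sk _ n)
    before : OrientedCycle noFrozen (iter FinP._≟_ M m n) i (m n) o
    before = OrientedCycle-≐ {fr = noFrozen} (mutPart-Qseq n)
               ( arrow⇒≢ skQ i→j , arrow⇒≢ skQ j→o , arrow⇒≢ skQ o→i ∘ sym , ℕ.z≤n
               , inj₁ (i→j , j→o , o→i))
    after : OrientedCycle noFrozen (mutPart (Q (suc n))) i (m n) o
    after = OrientedCycle-≐ {fr = noFrozen} (mutPart-Qseq⁻¹ (suc n)) (preserving n i o before)
    reversed : NotAcyclic (mutPart (Q (suc n))) i (m n) o → Cyclic (mutPart (Q (suc n))) (m n) i o
    reversed (inj₁ (i→j′ , _)) =
      ⊥-elim (ℤP.<-asym i→j′ (subst (_< 0ℤ) (sym (μ-pivot _≟V_ (Q n) (inj₂ refl))) (ℤP.neg-mono-< i→j)))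
    reversed (inj₂ (j→i′ , o→j′ , i→o′)) = j→i′ , i→o′ , o→j′

  mutable-preserved : CyclePreservingSeq FinP._≟_ noFrozen M m → ∀ n u w
    → OrientedCycle noFrozen (mutPart (Q n)) u (m n) w → OrientedCycle noFrozen (mutPart (Q (suc n))) u (m n) w
  mutable-preserved preserving n u w =
    OrientedCycle-≐ {fr = noFrozen} (mutPart-Qseq⁻¹ (suc n))
    ∘ preserving n u w
    ∘ OrientedCycle-≐ {fr = noFrozen} (mutPart-Qseq n)

  cycle-preserving-from : MutationAbundant M → CyclePreservingSeq FinP._≟_ noFrozen M m → Reduced m
    → PhaseBefore b (m 0)
    → Eventually (λ n → CyclePreservingAt _≟V_ frozenV (Q n) (inj₁ (m n)))
  cycle-preserving-from abundant preserving reduced start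
    with Evolution.eventually-preserving b m sk (heavy-iterates abundant) (keeps-cycles preserving) reduced start
  ... | s , frozen = s , λ n s≤n → cycle-preserving-at {B = Q n} (mutable-preserved preserving n) (frozen n s≤n)

module _ {f : ℕ} {b : Mat (Vtx f)} (sk : Skew b) where

  negate-abundant : MutationAbundant (mutPart b) → MutationAbundant (mutPart (negate b))
  negate-abundant abundant ks i j i≢j = subst (2 ℕ.≤_) (sym same-size) (abundant ks i j i≢j)
    where
    same-size : ∣ mutList FinP._≟_ (mutPart (negate b)) ks i j ∣ ≡ ∣ mutList FinP._≟_ (mutPart b) ks i j ∣
    same-size = trans (cong ∣_∣ (mutList-negate FinP._≟_ (mutPart b) ks i j))
                      (ℤP.∣-i∣≡∣i∣ (mutList FinP._≟_ (mutPart b) ks i j))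

  negate-preserving : ∀ {m} → CyclePreservingSeq FinP._≟_ noFrozen (mutPart b) m
                    → CyclePreservingSeq FinP._≟_ noFrozen (mutPart (negate b)) m
  negate-preserving {m} preserving n =
    CyclePreservingAt-reverse FinP._≟_ noFrozen (iter-skew FinP._≟_ (mutPart-skew (negate-skew sk)) m n)
      (λ x y → sym (trans (cong -_ (iter-negate FinP._≟_ (mutPart b) m n x y)) (ℤP.neg-involutive _)))
      (preserving n)

  unnegate : ∀ {m n} → CyclePreservingAt _≟V_ frozenV (Qseq (negate b) m n) (inj₁ (m n))
           → CyclePreservingAt _≟V_ frozenV (Qseq b m n) (inj₁ (m n))
  unnegate {n = n} = CyclePreservingAt-reverse _≟V_ frozenV (iter-skew _≟V_ sk _ n) (iter-negate _≟V_ b _ n)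

abundant⇒nonzero : ∀ {M : Mat (Fin 3)} → MutationAbundant M → ∀ u v → u ≢ v → M u v ≢ 0ℤ
abundant⇒nonzero abundant u v u≢v Muv≡0
  with () ← subst (λ z → 2 ℕ.≤ ∣ z ∣) Muv≡0 (abundant [] u v u≢v)

eventually-cycle-preserving : ∀ {f} (b : Mat (Vtx f)) → Skew b → MutationAbundant (mutPart b)
  → ∀ m → Reduced m → CyclePreservingSeq FinP._≟_ noFrozen (mutPart b) m
  → Eventually (λ n → CyclePreservingAt _≟V_ frozenV (Qseq b m n) (inj₁ (m n)))
eventually-cycle-preserving b sk abundant m reduced preserving
  with tournament (mutPart-skew sk) (abundant⇒nonzero abundant)
... | inj₁ cyc = cycle-preserving-from b m sk abundant preserving reduced (inj₁ cyc)
... | inj₂ (s , mid , t , chain) with m 0 FinP.≟ t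
...   | no m₀≢t =
  cycle-preserving-from b m sk abundant preserving reduced (inj₂ (s , mid , t , chain , m₀≢t))
...   | yes m₀≡t
  -- Reversing all arrows turns the sink t into a source.
  with cycle-preserving-from (negate b) m (negate-skew sk) (negate-abundant sk abundant)
         (negate-preserving sk preserving) reduced
         (inj₂ (t , mid , s , Transitive-negate (mutPart-skew sk) chain ,
                λ m₀≡s → arrow⇒≢ (mutPart-skew sk) (proj₂ (proj₂ chain)) (trans (sym m₀≡s) m₀≡t)))
... | s₀ , reversed = s₀ , λ n s₀≤n → unnegate sk {m} {n} (reversed n s₀≤n)

open import Data.Nat using (_+_)

eventually⇒suffix : ∀ {f} (b : Mat (Vtx f)) m
  → Eventually (λ n → CyclePreservingAt _≟V_ frozenV (Qseq b m n) (inj₁ (m n)))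
  → ∃[ s ] CyclePreservingSeq _≟V_ frozenV (Qseq b m s) (λ n → inj₁ (m (s + n)))
eventually⇒suffix b m (s , preserving) = s , λ n →
  subst (λ B → CyclePreservingAt _≟V_ frozenV B (inj₁ (m (s + n))))
        (iter-+ _≟V_ b (λ k → inj₁ (m k)) s n) (preserving (s + n) (ℕP.m≤m+n s n))

lemma6p9 : (f : ℕ) (b : Mat (Vtx f)) → Skew b → Connected b
    → MutationAbundant (mutPart b)
    → (m : ℕ → Fin 3) → Reduced m → WeaklyBalanced m
    → CyclePreservingSeq FinP._≟_ noFrozen (mutPart b) m
    → ∃[ s ] CyclePreservingSeq _≟V_ frozenV (Qseq b m s) (λ n → inj₁ (m (s + n)))
lemma6p9 f b sk _ abundant m reduced _ preserving =
  eventually⇒suffix b m (eventually-cycle-preserving b sk abundant m reduced preserving)
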